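{- For every $n\in\mathbb{N}$, as formal power series in $t$ over $\mathbb{Q}(q)$, $$\frac{C_{B_n}(q,t)}{\prod_{i=0}^n (1-q^i t)} = \sum_{k\geq 0} \left( [k+1]_q + [k]_q \right)^n t^k = \mathrm{Ehr}_{[-1,1]^n, \bar{\boldsymbol{\mu}}_n}(q,t).$$ In particular, $\sum_{k\ge0}(2k+1)^nt^k=\frac{\sum_{w\in B_n}t^{\mathrm{des}(w)}}{(1-t)^{n+1}}$, i.e. the Eulerian numbers of type $\mathsf{B}$ are the coefficients of the $h^*$-polynomial of the cube $[-1,1]^n$.
   Context: $B_n$ is the set of signed permutations: sequences $w=w_1\dots w_n$ of integers with $(|w_1|,\dots,|w_n|)$ a permutation of $[n]$. With $w_0:=0$, $\mathrm{Des}(w)=\{i\in\{0,\dots,n-1\}:w_i>w_{i+1}\}$, $\mathrm{maj}(w)=\sum_{i\in\mathrm{Des}(w)}i$, $\mathrm{des}(w)=|\mathrm{Des}(w)|$, $C_{B_n}(q,t)=\sum_{w\in B_n}q^{\mathrm{maj}(w)}t^{\mathrm{des}(w)}$. $[m]_q=\frac{1-q^m}{1-q}$. For $k\ge0$ and $x\in k[-1,1]^n\cap\mathbb{Z}^n$ (viewed as the product of $n$ one-dimensional cross polytopes) the weight is $\bar\mu_{k,n}(x)=\sum_{i=1}^n(k-|x_i|)$, and $\mathrm{Ehr}_{[-1,1]^n,\bar{\boldsymbol\mu}_n}(q,t)=\sum_{k\ge0}\sum_{x\in k[-1,1]^n\cap\mathbb{Z}^n}q^{\bar\mu_{k,n}(x)}t^k$.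 -}

module Defs where

open import Data.Nat as ℕ using (ℕ; zero; suc; _∸_)
open import Data.Integer as ℤ using (ℤ; +_; ∣_∣)
open import Data.List using (List; []; _∷_; map; foldr; concatMap; length; upTo)
open import Data.Bool using (Bool; true; false; if_then_else_; _∧_)
open import Data.Product using (_×_)
open import Relation.Nullary using (does)
open import Relation.Binary.PropositionalEquality using (_≡_)
open import Data.List.Relation.Binary.Permutation.Propositional using (_↭_)

module Series {A : Set} (0# 1# : A) (_+_ _*_ : A → A → A) (-_ : A → A) where

  Ser : Set
  Ser = ℕ → A

  sumUpTo : ℕ → (ℕ → A) → A
  sumUpTo zero    f = 0#
  sumUpTo (suc m) f = sumUpTo m f + f m

  zeroS : Ser
  zeroS _ = 0#

  oneS : Ser
  oneS zero    = 1#
  oneS (suc _) = 0#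

  monoS : A → ℕ → Ser
  monoS c d k = if does (k ℕ.≟ d) then c else 0#

  _⊕_ : Ser → Ser → Ser
  (f ⊕ g) k = f k + g k

  ⊖_ : Ser → Ser
  (⊖ f) k = - f k

  _⊝_ : Ser → Ser → Ser
  f ⊝ g = f ⊕ (⊖ g)

  _⊗_ : Ser → Ser → Ser
  (f ⊗ g) k = sumUpTo (suc k) (λ i → f i * g (k ∸ i))

  _^S_ : Ser → ℕ → Ser
  f ^S zero  = oneS
  f ^S suc m = f ⊗ (f ^S m)

  sumS : List Ser → Ser
  sumS = foldr _⊕_ zeroS

  prodS : List Ser → Ser
  prodS = foldr _⊗_ oneS

  private
    idx : List A → ℕ → A
    idx []       _       = 0#
    idx (x ∷ _)  zero    = x
    idx (_ ∷ xs) (suc j) = idx xs j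

    -- go f k = [b_k , b_{k-1} , … , b_0]  where  b = f⁻¹
    go : Ser → ℕ → List A
    go f zero    = 1# ∷ []
    go f (suc k) = (- sumUpTo (suc k) (λ j → f (suc j) * idx (go f k) j)) ∷ go f k

  -- Multiplicative inverse of a series whose constant coefficient is 1:
  --   b_0 = 1,   b_k = - Σ_{j=1}^{k} f_j b_{k-j}.
  -- (Only used for series with constant term 1.)
  invS : Ser → Ser
  invS f k = idx (go f k) 0

-- Z[[q]] : series in q with integer coefficients (polynomials in q live here)

module PQ = Series (+ 0) (+ 1) ℤ._+_ ℤ._*_ ℤ.-_

P : Set
P = PQ.Ser

qPow : ℕ → P
qPow a = PQ.monoS (+ 1) a

-- [m]_q = 1 + q + … + q^(m-1)
qInt : ℕ → P
qInt m a = if does (a ℕ.<? m) then + 1 else + 0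

-- Z[[q]][[t]] : series in t with coefficients in Z[[q]].
-- T k a = coefficient of t^k q^a.

module TQ = Series PQ.zeroS PQ.oneS PQ._⊕_ PQ._⊗_ PQ.⊖_

T : Set
T = TQ.Ser

qtMono : ℕ → ℕ → T
qtMono a k = TQ.monoS (qPow a) k

_≈T_ : T → T → Set
X ≈T Y = ∀ k a → X k a ≡ Y k a

-- Z[[t]] : series in t with integer coefficients (the specialisation q = 1)

module U = Series (+ 0) (+ 1) ℤ._+_ ℤ._*_ ℤ.-_

_≈U_ : U.Ser → U.Ser → Set
X ≈U Y = ∀ k → X k ≡ Y k

IsSignedPerm : ℕ → List ℤ → Set
IsSignedPerm n w = map ∣_∣ w ↭ map suc (upTo n)

-- descentsFrom i prev w : the positions j (numbered from i) with w_j > w_{j+1},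
-- where prev plays the role of w_i.
descentsFrom : ℕ → ℤ → List ℤ → List ℕ
descentsFrom i prev []       = []
descentsFrom i prev (x ∷ xs) =
  if does (x ℤ.<? prev) then i ∷ descentsFrom (suc i) x xs
                        else descentsFrom (suc i) x xs

-- Des(w) ⊆ {0,…,n-1}, with the convention w_0 = 0
Des : List ℤ → List ℕ
Des w = descentsFrom 0 (+ 0) w

maj : List ℤ → ℕ
maj w = foldr ℕ._+_ 0 (Des w)

des : List ℤ → ℕ
des w = length (Des w)

-- C_{B_n}(q,t) = Σ_{w ∈ B_n} q^maj(w) t^des(w), the sum taken over a list
-- enumerating B_n.
CB : List (List ℤ) → T
CB L = TQ.sumS (map (λ w → qtMono (maj w) (des w)) L)

CBdes : List (List ℤ) → U.Ser
CBdes L = U.sumS (map (λ w → U.monoS (+ 1) (des w)) L)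

denom : ℕ → T
denom n = TQ.prodS (map (λ i → TQ.oneS TQ.⊝ qtMono i 1) (upTo (suc n)))

qSeries : ℕ → T
qSeries n k = (qInt (suc k) PQ.⊕ qInt k) PQ.^S n

range : ℕ → List ℤ
range k = map (λ i → + i ℤ.- + k) (upTo (suc (2 ℕ.* k)))

box : ℕ → ℕ → List (List ℤ)
box k zero    = [] ∷ []
box k (suc n) = concatMap (λ x → map (x ∷_) (box k n)) (range k)

muBar : ℕ → List ℤ → ℕ
muBar k x = foldr ℕ._+_ 0 (map (λ xi → k ∸ ∣ xi ∣) x)

Ehr : ℕ → T
Ehr n k = PQ.sumS (map (λ x → qPow (muBar k x)) (box k n))

-- For an increasing list V of distinct integers, a first descent position i and a letter c
-- standing in front of the word, the generating function of q^maj t^des over all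
-- permutations of V is a Carlitz-type quotient
--   (Σ_k q^(ik) ∏_{y ∈ V} [k + (y ≥ c)]_q t^k) / ∏_{j=i}^{i+|V|} (1 - q^j t).
-- Removing the first letter y shifts i by one, replaces c by y and contributes q^i t exactly
-- when y < c; the resulting recursion for the numerators is a telescoping identity for products
-- of consecutive q-integers. Signed permutations are the permutations of the 2^n increasing
-- lists with one of ±j for each j ≤ n; summing over them with c = 0 turns the product into
-- ([k+1]_q + [k]_q)^n, which is also the μ̄-weighted count of the lattice points of k[-1,1]^n,
-- one coordinate at a time. Setting q = 1 gives the Eulerian statement.

module Submission where

open import Level using (0ℓ)
open import Algebra.Bundles using (CommutativeRing)
open import Data.Nat as ℕ using (ℕ; zero; suc; _∸_)
import Data.Nat.Properties as ℕ
open import Data.Product using (Σ; ∃; _×_; _,_; proj₁; proj₂; map₂; uncurry)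
open import Data.Integer as ℤ using (ℤ; +_; -[1+_]; ∣_∣)
import Data.Integer.Properties as ℤ
open import Data.Bool using (Bool; true; false; if_then_else_)
open import Data.List using (List; []; _∷_; _++_; map; foldr; concatMap; length; applyUpTo; upTo)
import Data.List.Properties as List
open import Data.List.Relation.Unary.All as All using (All; []; _∷_)
import Data.List.Relation.Unary.All.Properties as All
open import Data.List.Relation.Unary.Any using (here; there)
open import Data.List.Relation.Unary.AllPairs as AllPairs using (AllPairs; []; _∷_)
import Data.List.Relation.Unary.AllPairs.Properties as AllPairs
open import Data.List.Relation.Unary.Unique.Propositional using (Unique)
import Data.List.Relation.Unary.Unique.Propositional.Properties as Unique
open import Data.List.Relation.Binary.Disjoint.Propositional using (Disjoint)
open import Data.List.Membership.Propositional using (_∈_)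
open import Data.List.Membership.Propositional.Properties
  using (∈-map⁺; ∈-map⁻; ∈-++⁺ʳ; ∈-∃++; ∈-concat⁺′; ∈-concat⁻′)
open import Data.List.Membership.Propositional.Properties.WithK using (unique∧set⇒bag)
open import Data.List.Relation.Binary.BagAndSetEquality using (∼bag⇒↭)
open import Data.List.Relation.Unary.Linked.Properties using (AllPairs⇒Linked)
open import Data.List.Relation.Unary.Sorted.TotalOrder.Properties using (↗↭↗⇒≋)
open import Data.List.Relation.Binary.Pointwise using (Pointwise-≡⇒≡)
open import Function.Bundles using (_⇔_; mk⇔; Equivalence)
open import Data.List.Relation.Binary.Permutation.Propositional
  using (_↭_; ↭-refl; ↭-sym; ↭-trans; ↭-prep; ↭-swap; ↭⇒↭ₛ; ↭⇒↭ₛ′)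
import Data.List.Relation.Binary.Permutation.Propositional.Properties as ↭
import Data.List.Relation.Binary.Permutation.Setoid.Properties as SetoidPermutation
open import Function using (_∘_; _on_)
open import Relation.Nullary using (Dec; does; yes; no; ¬_; contradiction)
open import Relation.Nullary.Decidable using (dec-true; dec-false)
open import Relation.Binary.Definitions using (tri<; tri≈; tri>)
open import Relation.Binary.PropositionalEquality as ≡ using (_≡_; _≢_)
import Relation.Binary.Reasoning.Setoid as SetoidReasoning
import Algebra.Solver.Ring.NaturalCoefficients.Default as NaturalSolver
open import Data.Nat.Tactic.RingSolver using (solve-∀)
import Algebra.Properties.Ring as RingProperties
import Algebra.Properties.Semiring.Exp as Exp
import Algebra.Properties.Group as GroupProperties
import Algebra.Properties.CommutativeSemigroup as CommutativeSemigroupProperties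
open import Defs

module ListSum {ℓ} (R : CommutativeRing 0ℓ ℓ) where
  open CommutativeRing R
  open SetoidReasoning setoid
  open CommutativeSemigroupProperties +-commutativeSemigroup using (interchange)

  ∑ : List Carrier → Carrier
  ∑ = foldr _+_ 0#

  ∏ : List Carrier → Carrier
  ∏ = foldr _*_ 1#

  ∏-++ : ∀ xs ys → ∏ (xs ++ ys) ≈ ∏ xs * ∏ ys
  ∏-++ []       ys = sym (*-identityˡ _)
  ∏-++ (x ∷ xs) ys = trans (*-cong refl (∏-++ xs ys)) (sym (*-assoc _ _ _))

  ∑-++ : ∀ xs ys → ∑ (xs ++ ys) ≈ ∑ xs + ∑ ys
  ∑-++ []       ys = sym (+-identityˡ _)
  ∑-++ (x ∷ xs) ys = trans (+-cong refl (∑-++ xs ys)) (sym (+-assoc _ _ _))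

  ∑-↭ : ∀ {xs ys} → xs ↭ ys → ∑ xs ≈ ∑ ys
  ∑-↭ xs↭ys = SetoidPermutation.foldr-commMonoid setoid +-isCommutativeMonoid
                (↭⇒↭ₛ′ isEquivalence xs↭ys)

  module _ {A : Set} where

    ∑-map-cong-All : ∀ {xs} {f g : A → Carrier} → All (λ x → f x ≈ g x) xs →
                     ∑ (map f xs) ≈ ∑ (map g xs)
    ∑-map-cong-All []            = refl
    ∑-map-cong-All (fx≈gx ∷ f≈g) = +-cong fx≈gx (∑-map-cong-All f≈g)

    ∑-map-cong : ∀ xs {f g : A → Carrier} → (∀ x → f x ≈ g x) → ∑ (map f xs) ≈ ∑ (map g xs)
    ∑-map-cong xs f≈g = ∑-map-cong-All (All.universal f≈g xs)

    ∑-map-*ˡ : ∀ xs (f : A → Carrier) c → ∑ (map (λ x → c * f x) xs) ≈ c * ∑ (map f xs)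
    ∑-map-*ˡ []       f c = sym (zeroʳ c)
    ∑-map-*ˡ (x ∷ xs) f c = trans (+-cong refl (∑-map-*ˡ xs f c)) (sym (distribˡ c _ _))

    ∑-map-*ʳ : ∀ xs (f : A → Carrier) c → ∑ (map (λ x → f x * c) xs) ≈ ∑ (map f xs) * c
    ∑-map-*ʳ []       f c = sym (zeroˡ c)
    ∑-map-*ʳ (x ∷ xs) f c = trans (+-cong refl (∑-map-*ʳ xs f c)) (sym (distribʳ c _ _))

    ∑-map-+ : ∀ xs (f g : A → Carrier) →
              ∑ (map (λ x → f x + g x) xs) ≈ ∑ (map f xs) + ∑ (map g xs)
    ∑-map-+ []       f g = sym (+-identityˡ _)
    ∑-map-+ (x ∷ xs) f g = trans (+-cong refl (∑-map-+ xs f g)) (interchange _ _ _ _)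

    ∑-concatMap : ∀ {B : Set} xs (f : A → List B) (g : B → Carrier) →
                  ∑ (map g (concatMap f xs)) ≈ ∑ (map (λ x → ∑ (map g (f x))) xs)
    ∑-concatMap []       f g = refl
    ∑-concatMap (x ∷ xs) f g = begin
      ∑ (map g (f x ++ concatMap f xs))             ≡⟨ ≡.cong ∑ (List.map-++ g (f x) _) ⟩
      ∑ (map g (f x) ++ map g (concatMap f xs))     ≈⟨ ∑-++ (map g (f x)) _ ⟩
      ∑ (map g (f x)) + ∑ (map g (concatMap f xs))  ≈⟨ +-cong refl (∑-concatMap xs f g) ⟩
      ∑ (map g (f x)) + ∑ (map (λ x → ∑ (map g (f x))) xs) ∎

module PowerSeries {ℓ} (R : CommutativeRing 0ℓ ℓ) where
  open CommutativeRing R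
  open Series 0# 1# _+_ _*_ -_ public
  open ListSum R using (∑; ∑-++)
  open SetoidReasoning setoid
  open NaturalSolver commutativeSemiring using (solve; _:=_; _:+_; _:*_)
  open CommutativeSemigroupProperties +-commutativeSemigroup using (interchange)
  open RingProperties ring using (-0#≈0#)

  infix 4 _≋_
  _≋_ : Ser → Ser → Set ℓ
  f ≋ g = ∀ k → f k ≈ g k

  ≋-refl : ∀ {f} → f ≋ f
  ≋-refl k = refl

  ≋-sym : ∀ {f g} → f ≋ g → g ≋ f
  ≋-sym f≋g k = sym (f≋g k)

  ≋-trans : ∀ {f g h} → f ≋ g → g ≋ h → f ≋ h
  ≋-trans f≋g g≋h k = trans (f≋g k) (g≋h k)

  ≡⇒≋ : ∀ {f g} → f ≡ g → f ≋ g
  ≡⇒≋ ≡.refl = ≋-refl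

  sumUpTo-cong< : ∀ m {f g : ℕ → Carrier} → (∀ i → i ℕ.< m → f i ≈ g i) →
                  sumUpTo m f ≈ sumUpTo m g
  sumUpTo-cong< zero    f≈g = refl
  sumUpTo-cong< (suc m) f≈g =
    +-cong (sumUpTo-cong< m (λ i i<m → f≈g i (ℕ.m<n⇒m<1+n i<m))) (f≈g m (ℕ.n<1+n m))

  sumUpTo-cong : ∀ m {f g : ℕ → Carrier} → (∀ i → f i ≈ g i) → sumUpTo m f ≈ sumUpTo m g
  sumUpTo-cong m f≈g = sumUpTo-cong< m (λ i _ → f≈g i)

  sumUpTo-+ : ∀ m (f g : ℕ → Carrier) →
              sumUpTo m (λ i → f i + g i) ≈ sumUpTo m f + sumUpTo m g
  sumUpTo-+ zero    f g = sym (+-identityˡ 0#)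
  sumUpTo-+ (suc m) f g = trans (+-cong (sumUpTo-+ m f g) refl) (interchange _ _ _ _)

  *-sumUpTo : ∀ m x (f : ℕ → Carrier) → x * sumUpTo m f ≈ sumUpTo m (λ i → x * f i)
  *-sumUpTo zero    x f = zeroʳ x
  *-sumUpTo (suc m) x f = trans (distribˡ x _ _) (+-cong (*-sumUpTo m x f) refl)

  sumUpTo-zero : ∀ m (f : ℕ → Carrier) → (∀ i → f i ≈ 0#) → sumUpTo m f ≈ 0#
  sumUpTo-zero zero    f f≈0 = refl
  sumUpTo-zero (suc m) f f≈0 = trans (+-cong (sumUpTo-zero m f f≈0) (f≈0 m)) (+-identityˡ 0#)

  sumUpTo-suc : ∀ m (f : ℕ → Carrier) → sumUpTo (suc m) f ≈ f 0 + sumUpTo m (f ∘ suc)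
  sumUpTo-suc zero    f = +-comm 0# (f 0)
  sumUpTo-suc (suc m) f = trans (+-cong (sumUpTo-suc m f) refl) (+-assoc _ _ _)

  sumUpTo-reverse : ∀ m (f : ℕ → Carrier) → sumUpTo m f ≈ sumUpTo m (λ i → f (m ∸ suc i))
  sumUpTo-reverse zero    f = refl
  sumUpTo-reverse (suc m) f = begin
    sumUpTo m f + f m                        ≈⟨ +-cong (sumUpTo-reverse m f) refl ⟩
    sumUpTo m (λ i → f (m ∸ suc i)) + f m    ≈⟨ +-comm _ _ ⟩
    f m + sumUpTo m (λ i → f (m ∸ suc i))    ≈⟨ sumUpTo-suc m (λ i → f (suc m ∸ suc i)) ⟨
    sumUpTo (suc m) (λ i → f (suc m ∸ suc i)) ∎

  sumUpTo-split : ∀ a b (f : ℕ → Carrier) →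
                  sumUpTo (a ℕ.+ b) f ≈ sumUpTo a f + sumUpTo b (λ j → f (a ℕ.+ j))
  sumUpTo-split a zero    f = trans (reflexive (≡.cong (λ m → sumUpTo m f) (ℕ.+-identityʳ a)))
                                    (sym (+-identityʳ _))
  sumUpTo-split a (suc b) f = begin
    sumUpTo (a ℕ.+ suc b) f                                ≡⟨ ≡.cong (λ m → sumUpTo m f) (ℕ.+-suc a b) ⟩
    sumUpTo (a ℕ.+ b) f + f (a ℕ.+ b)                      ≈⟨ +-cong (sumUpTo-split a b f) refl ⟩
    (sumUpTo a f + sumUpTo b (λ j → f (a ℕ.+ j))) + f (a ℕ.+ b)  ≈⟨ +-assoc _ _ _ ⟩
    sumUpTo a f + sumUpTo (suc b) (λ j → f (a ℕ.+ j))      ∎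

  ∑-map-upTo : ∀ m (f : ℕ → Carrier) → ∑ (map f (upTo m)) ≈ sumUpTo m f
  ∑-map-upTo zero    f = refl
  ∑-map-upTo (suc m) f = begin
    ∑ (map f (upTo (suc m)))           ≡⟨ ≡.cong (∑ ∘ map f) (List.upTo-∷ʳ m) ⟨
    ∑ (map f (upTo m ++ m ∷ []))       ≡⟨ ≡.cong ∑ (List.map-++ f (upTo m) (m ∷ [])) ⟩
    ∑ (map f (upTo m) ++ f m ∷ [])     ≈⟨ ∑-++ (map f (upTo m)) (f m ∷ []) ⟩
    ∑ (map f (upTo m)) + (f m + 0#)    ≈⟨ +-cong (∑-map-upTo m f) (+-identityʳ _) ⟩
    sumUpTo m f + f m                  ∎

  ⊗-cong : ∀ {f f′ g g′} → f ≋ f′ → g ≋ g′ → f ⊗ g ≋ f′ ⊗ g′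
  ⊗-cong f≋f′ g≋g′ k = sumUpTo-cong (suc k) (λ i → *-cong (f≋f′ i) (g≋g′ (k ∸ i)))

  ⊗-congˡ : ∀ f {g g′} → g ≋ g′ → f ⊗ g ≋ f ⊗ g′
  ⊗-congˡ f = ⊗-cong {f} ≋-refl

  ⊗-congʳ : ∀ {f f′} g → f ≋ f′ → f ⊗ g ≋ f′ ⊗ g
  ⊗-congʳ g f≋f′ = ⊗-cong {g = g} f≋f′ ≋-refl

  ⊗-zero : ∀ f g → (f ⊗ g) 0 ≈ f 0 * g 0
  ⊗-zero f g = +-identityˡ _

  ⊗-suc : ∀ f g k → (f ⊗ g) (suc k) ≈ f 0 * g (suc k) + ((f ∘ suc) ⊗ g) k
  ⊗-suc f g k = sumUpTo-suc (suc k) _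

  ⊗-comm : ∀ f g → f ⊗ g ≋ g ⊗ f
  ⊗-comm f g k = begin
    sumUpTo (suc k) (λ i → f i * g (k ∸ i))             ≈⟨ sumUpTo-reverse (suc k) _ ⟩
    sumUpTo (suc k) (λ i → f (k ∸ i) * g (k ∸ (k ∸ i))) ≈⟨ sumUpTo-cong< (suc k) swapped ⟩
    sumUpTo (suc k) (λ i → g i * f (k ∸ i))             ∎
    where
    swapped : ∀ i → i ℕ.< suc k → f (k ∸ i) * g (k ∸ (k ∸ i)) ≈ g i * f (k ∸ i)
    swapped i i<1+k =
      trans (*-comm _ _) (*-cong (reflexive (≡.cong g (ℕ.m∸[m∸n]≡n (ℕ.≤-pred i<1+k)))) refl)

  ⊗-distribˡ : ∀ f g h → f ⊗ (g ⊕ h) ≋ (f ⊗ g) ⊕ (f ⊗ h)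
  ⊗-distribˡ f g h k = trans (sumUpTo-cong (suc k) (λ i → distribˡ _ _ _)) (sumUpTo-+ (suc k) _ _)

  ⊗-distribʳ : ∀ f g h → (g ⊕ h) ⊗ f ≋ (g ⊗ f) ⊕ (h ⊗ f)
  ⊗-distribʳ f g h k = trans (sumUpTo-cong (suc k) (λ i → distribʳ _ _ _)) (sumUpTo-+ (suc k) _ _)

  infixr 7 _•_
  _•_ : Carrier → Ser → Ser
  (x • g) k = x * g k

  •-⊗ : ∀ x g h → (x • g) ⊗ h ≋ x • (g ⊗ h)
  •-⊗ x g h k = trans (sumUpTo-cong (suc k) (λ i → *-assoc _ _ _)) (sym (*-sumUpTo (suc k) x _))

  ⊗-assoc : ∀ f g h → (f ⊗ g) ⊗ h ≋ f ⊗ (g ⊗ h)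
  ⊗-assoc f g h zero = begin
    ((f ⊗ g) ⊗ h) 0    ≈⟨ ⊗-zero (f ⊗ g) h ⟩
    (f ⊗ g) 0 * h 0    ≈⟨ *-cong (⊗-zero f g) refl ⟩
    (f 0 * g 0) * h 0  ≈⟨ *-assoc _ _ _ ⟩
    f 0 * (g 0 * h 0)  ≈⟨ *-cong refl (⊗-zero g h) ⟨
    f 0 * (g ⊗ h) 0    ≈⟨ ⊗-zero f (g ⊗ h) ⟨
    (f ⊗ (g ⊗ h)) 0    ∎
  ⊗-assoc f g h (suc k) = begin
    ((f ⊗ g) ⊗ h) (suc k)
      ≈⟨ ⊗-suc (f ⊗ g) h k ⟩
    (f ⊗ g) 0 * h (suc k) + (((f ⊗ g) ∘ suc) ⊗ h) k
      ≈⟨ +-cong (*-cong (⊗-zero f g) refl) (⊗-congʳ h tail-⊗ k) ⟩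
    (f 0 * g 0) * h (suc k) + ((((f ∘ suc) ⊗ g) ⊕ (f 0 • (g ∘ suc))) ⊗ h) k
      ≈⟨ +-cong refl (⊗-distribʳ h ((f ∘ suc) ⊗ g) (f 0 • (g ∘ suc)) k) ⟩
    (f 0 * g 0) * h (suc k) + ((((f ∘ suc) ⊗ g) ⊗ h) k + ((f 0 • (g ∘ suc)) ⊗ h) k)
      ≈⟨ +-cong refl (+-cong (⊗-assoc (f ∘ suc) g h k) (•-⊗ (f 0) (g ∘ suc) h k)) ⟩
    (f 0 * g 0) * h (suc k) + (((f ∘ suc) ⊗ (g ⊗ h)) k + f 0 * ((g ∘ suc) ⊗ h) k)
      ≈⟨ regroup (f 0) (g 0) (h (suc k)) (((g ∘ suc) ⊗ h) k) (((f ∘ suc) ⊗ (g ⊗ h)) k) ⟩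
    f 0 * (g 0 * h (suc k) + ((g ∘ suc) ⊗ h) k) + ((f ∘ suc) ⊗ (g ⊗ h)) k
      ≈⟨ +-cong (*-cong refl (⊗-suc g h k)) refl ⟨
    f 0 * (g ⊗ h) (suc k) + ((f ∘ suc) ⊗ (g ⊗ h)) k
      ≈⟨ ⊗-suc f (g ⊗ h) k ⟨
    (f ⊗ (g ⊗ h)) (suc k) ∎
    where
    tail-⊗ : (f ⊗ g) ∘ suc ≋ ((f ∘ suc) ⊗ g) ⊕ (f 0 • (g ∘ suc))
    tail-⊗ k = trans (⊗-suc f g k) (+-comm _ _)
    regroup : ∀ a b x y z → (a * b) * x + (z + a * y) ≈ a * (b * x + y) + z
    regroup = solve 5 (λ a b x y z → (a :* b) :* x :+ (z :+ a :* y) := a :* (b :* x :+ y) :+ z) refl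

  ⊗-identityˡ : ∀ f → oneS ⊗ f ≋ f
  ⊗-identityˡ f k = begin
    (oneS ⊗ f) k                                         ≈⟨ sumUpTo-suc k _ ⟩
    1# * f k + sumUpTo k (λ i → 0# * f (k ∸ suc i))
      ≈⟨ +-cong (*-identityˡ _) (sumUpTo-zero k _ (λ i → zeroˡ _)) ⟩
    f k + 0#                                             ≈⟨ +-identityʳ _ ⟩
    f k                                                  ∎

  ⊗-identityʳ : ∀ f → f ⊗ oneS ≋ f
  ⊗-identityʳ f = ≋-trans (⊗-comm f oneS) (⊗-identityˡ f)

  ⊕-⊗-commutativeRing : CommutativeRing 0ℓ ℓ
  ⊕-⊗-commutativeRing = record
    { Carrier = Ser ; _≈_ = _≋_ ; _+_ = _⊕_ ; _*_ = _⊗_ ; -_ = ⊖_ ; 0# = zeroS ; 1# = oneS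
    ; isCommutativeRing = record
      { isRing = record
        { +-isAbelianGroup = record
          { isGroup = record
            { isMonoid = record
              { isSemigroup = record
                { isMagma = record
                  { isEquivalence = record { refl = ≋-refl ; sym = ≋-sym ; trans = ≋-trans }
                  ; ∙-cong = λ f≋f′ g≋g′ k → +-cong (f≋f′ k) (g≋g′ k) }
                ; assoc = λ f g h k → +-assoc _ _ _ }
              ; identity = (λ f k → +-identityˡ _) , (λ f k → +-identityʳ _) }
            ; inverse = (λ f k → -‿inverseˡ _) , (λ f k → -‿inverseʳ _)
            ; ⁻¹-cong = λ f≋g k → -‿cong (f≋g k) }
          ; comm = λ f g k → +-comm _ _ }
        ; *-cong = ⊗-cong
        ; *-assoc = ⊗-assoc
        ; *-identity = ⊗-identityˡ , ⊗-identityʳ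
        ; distrib = ⊗-distribˡ , ⊗-distribʳ }
      ; *-comm = ⊗-comm } }

  open Exp (CommutativeRing.semiring ⊕-⊗-commutativeRing) using () renaming (_^_ to _^⊗_)

  ^⊗≋^S : ∀ f n → f ^⊗ n ≋ f ^S n
  ^⊗≋^S f zero    = ≋-refl
  ^⊗≋^S f (suc n) = ⊗-congˡ f (^⊗≋^S f n)

  prodS-const : ∀ {A : Set} f (xs : List A) → prodS (map (λ _ → f) xs) ≋ f ^S length xs
  prodS-const f []       = ≋-refl
  prodS-const f (x ∷ xs) = ⊗-congˡ f (prodS-const f xs)

  module ≋-Reasoning = SetoidReasoning (CommutativeRing.setoid ⊕-⊗-commutativeRing)

  open RingProperties (CommutativeRing.ring ⊕-⊗-commutativeRing) using ()
    renaming (-‿distribʳ-* to ⊖-⊗-distribʳ)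

  •-monoS : ∀ a b d → a • monoS b d ≋ monoS (a * b) d
  •-monoS a b d k with does (k ℕ.≟ d)
  ... | true  = refl
  ... | false = zeroʳ a

  monoS-cong : ∀ {a b} d → a ≈ b → monoS a d ≋ monoS b d
  monoS-cong d a≈b k with does (k ℕ.≟ d)
  ... | true  = a≈b
  ... | false = refl

  monoS-one : monoS 1# 0 ≋ oneS
  monoS-one zero    = refl
  monoS-one (suc k) = refl

  monoS-zero-⊗ : ∀ a g → monoS a 0 ⊗ g ≋ a • g
  monoS-zero-⊗ a g k = begin
    (monoS a 0 ⊗ g) k                                 ≈⟨ sumUpTo-suc k _ ⟩
    a * g k + sumUpTo k (λ i → 0# * g (k ∸ suc i))    ≈⟨ +-cong refl (sumUpTo-zero k _ (λ i → zeroˡ _)) ⟩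
    a * g k + 0#                                      ≈⟨ +-identityʳ _ ⟩
    a * g k                                           ∎

  monoS-suc-⊗-zero : ∀ a d g → (monoS a (suc d) ⊗ g) 0 ≈ 0#
  monoS-suc-⊗-zero a d g = trans (⊗-zero (monoS a (suc d)) g) (zeroˡ _)

  monoS-suc-⊗-suc : ∀ a d g k → (monoS a (suc d) ⊗ g) (suc k) ≈ (monoS a d ⊗ g) k
  monoS-suc-⊗-suc a d g k = trans (⊗-suc _ g k) (trans (+-cong (zeroˡ _) refl) (+-identityˡ _))

  monoS-⊗-monoS : ∀ a d b e → monoS a d ⊗ monoS b e ≋ monoS (a * b) (d ℕ.+ e)
  monoS-⊗-monoS a zero    b e         = ≋-trans (monoS-zero-⊗ a (monoS b e)) (•-monoS a b e)
  monoS-⊗-monoS a (suc d) b e zero    = monoS-suc-⊗-zero a d (monoS b e)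
  monoS-⊗-monoS a (suc d) b e (suc k) =
    trans (monoS-suc-⊗-suc a d (monoS b e) k) (monoS-⊗-monoS a d b e k)

  1-_·t : Carrier → Ser
  1- a ·t = oneS ⊝ monoS a 1

  [1-·t]-zero : ∀ a → (1- a ·t) 0 ≈ 1#
  [1-·t]-zero a = trans (+-cong refl -0#≈0#) (+-identityʳ 1#)

  ⊗-[1-·t]-zero : ∀ a f → (f ⊗ 1- a ·t) 0 ≈ f 0
  ⊗-[1-·t]-zero a f = trans (⊗-zero f (1- a ·t)) (trans (*-cong refl ([1-·t]-zero a)) (*-identityʳ _))

  ⊗-[1-·t]-suc : ∀ a f k → (f ⊗ 1- a ·t) (suc k) ≈ f (suc k) - a * f k
  ⊗-[1-·t]-suc a f k = begin
    (f ⊗ 1- a ·t) (suc k)                             ≈⟨ ⊗-distribˡ f oneS (⊖ monoS a 1) (suc k) ⟩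
    (f ⊗ oneS) (suc k) + (f ⊗ (⊖ monoS a 1)) (suc k)
      ≈⟨ +-cong (⊗-identityʳ f (suc k)) (sym (⊖-⊗-distribʳ f (monoS a 1) (suc k))) ⟩
    f (suc k) - (f ⊗ monoS a 1) (suc k)               ≈⟨ +-cong refl (-‿cong (⊗-comm f (monoS a 1) (suc k))) ⟩
    f (suc k) - (monoS a 1 ⊗ f) (suc k)               ≈⟨ +-cong refl (-‿cong (monoS-suc-⊗-suc a 0 f k)) ⟩
    f (suc k) - (monoS a 0 ⊗ f) k                     ≈⟨ +-cong refl (-‿cong (monoS-zero-⊗ a f k)) ⟩
    f (suc k) - a * f k                               ∎

  prodS-zero : ∀ fs → All (λ f → f 0 ≈ 1#) fs → prodS fs 0 ≈ 1#
  prodS-zero []       []           = refl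
  prodS-zero (f ∷ fs) (f₀≈1 ∷ fs₀≈1) =
    trans (⊗-zero f (prodS fs)) (trans (*-cong f₀≈1 (prodS-zero fs fs₀≈1)) (*-identityˡ 1#))

  sumS-coeff : ∀ {A : Set} xs (F : A → Ser) k → sumS (map F xs) k ≈ ∑ (map (λ x → F x k) xs)
  sumS-coeff []       F k = refl
  sumS-coeff (x ∷ xs) F k = +-cong refl (sumS-coeff xs F k)

  -- invS computes b_{m+1} from a private table of b_m, ..., b_0; unification recovers that table.
  private
    invS-table : (f : Ser) → Σ (ℕ → ℕ → Carrier) λ F →
      (∀ m → invS f (suc m) ≡ - sumUpTo (suc m) (λ j → f (suc j) * F m j)) ×
      (∀ m → F m 0 ≡ invS f m) × (∀ m j → F (suc m) (suc j) ≡ F m j)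
    invS-table f = _ , (λ m → ≡.refl) , (λ m → ≡.refl) , (λ m j → ≡.refl)

    table-lookup : (f : Ser) (F : ℕ → ℕ → Carrier) → (∀ m → F m 0 ≡ invS f m) →
                   (∀ m j → F (suc m) (suc j) ≡ F m j) → ∀ m j → j ℕ.≤ m → F m j ≡ invS f (m ∸ j)
    table-lookup f F F₀ F-suc m       zero    ℕ.z≤n     = F₀ m
    table-lookup f F F₀ F-suc (suc m) (suc j) (ℕ.s≤s j≤m) =
      ≡.trans (F-suc m j) (table-lookup f F F₀ F-suc m j j≤m)

  invS-suc : ∀ f m → invS f (suc m) ≈ - sumUpTo (suc m) (λ j → f (suc j) * invS f (m ∸ j))
  invS-suc f m with invS-table f
  ... | F , recurrence , F₀ , F-suc = trans (reflexive (recurrence m))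
    (-‿cong (sumUpTo-cong< (suc m) (λ j j<1+m →
      *-cong refl (reflexive (table-lookup f F F₀ F-suc m j (ℕ.≤-pred j<1+m))))))

  ⊗-invS : ∀ f → f 0 ≈ 1# → f ⊗ invS f ≋ oneS
  ⊗-invS f f₀≈1 zero    = trans (⊗-zero f (invS f)) (trans (*-cong f₀≈1 refl) (*-identityˡ _))
  ⊗-invS f f₀≈1 (suc m) = begin
    (f ⊗ invS f) (suc m)                      ≈⟨ ⊗-suc f (invS f) m ⟩
    f 0 * invS f (suc m) + tail               ≈⟨ +-cong (*-cong f₀≈1 (invS-suc f m)) refl ⟩
    1# * (- tail) + tail                      ≈⟨ +-cong (*-identityˡ _) refl ⟩
    - tail + tail                             ≈⟨ -‿inverseˡ tail ⟩
    0#                                        ∎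
    where tail = ((f ∘ suc) ⊗ invS f) m

  ⊗-invS-cancelʳ : ∀ f {g h} → f 0 ≈ 1# → g ≋ h ⊗ f → g ⊗ invS f ≋ h
  ⊗-invS-cancelʳ f {g} {h} f₀≈1 g≋hf =
    ≋-trans (⊗-congʳ (invS f) g≋hf) (≋-trans (⊗-assoc h f (invS f))
      (≋-trans (⊗-congˡ h (⊗-invS f f₀≈1)) (⊗-identityʳ h)))

allPairs-both : ∀ {A : Set} {P : A → Set} {R : A → A → Set} {xs} → All P xs → AllPairs R xs →
                AllPairs (λ x y → P x × P y × R x y) xs
allPairs-both []         []          = []
allPairs-both (px ∷ pxs) (Rx ∷ Rxs) =
  All.zipWith (λ (py , Rxy) → px , py , Rxy) (pxs , Rx) ∷ allPairs-both pxs Rxs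

module ConcatMap {A B : Set} (f : A → List B) where

  ∈-concatMap⁻ : ∀ xs {w} → w ∈ concatMap f xs → ∃ λ x → x ∈ xs × w ∈ f x
  ∈-concatMap⁻ xs w∈ with ∈-concat⁻′ (map f xs) w∈
  ... | ys , w∈ys , ys∈ with ∈-map⁻ f ys∈
  ... | x , x∈xs , ≡.refl = x , x∈xs , w∈ys

  ∈-concatMap⁺ : ∀ {xs x w} → x ∈ xs → w ∈ f x → w ∈ concatMap f xs
  ∈-concatMap⁺ x∈xs w∈fx = ∈-concat⁺′ w∈fx (∈-map⁺ f x∈xs)

  concatMap-unique : ∀ {xs} → All (Unique ∘ f) xs → AllPairs (Disjoint on f) xs →
                     Unique (concatMap f xs)
  concatMap-unique unique disjoint = Unique.concat⁺ (All.map⁺ unique) (AllPairs.map⁺ disjoint)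

module Picks {A : Set} where

  picks : List A → List (A × List A)
  picks []      = []
  picks (z ∷ W) = (z , W) ∷ map (map₂ (z ∷_)) (picks W)

  picks-first : ∀ {P : A → Set} {V} → All P V → All (P ∘ proj₁) (picks V)
  picks-first []         = []
  picks-first (pz ∷ pW) = pz ∷ All.map⁺ (picks-first pW)

  picks-rest : ∀ {P : A → Set} {V} → All P V → All (All P ∘ proj₂) (picks V)
  picks-rest []         = []
  picks-rest (pz ∷ pW) = pW ∷ All.map⁺ (All.map (pz ∷_) (picks-rest pW))

  picks-AllPairs : ∀ {R : A → A → Set} {V} → AllPairs R V → All (AllPairs R ∘ proj₂) (picks V)
  picks-AllPairs []          = []
  picks-AllPairs (zW ∷ pW) =
    pW ∷ All.map⁺ (All.zipWith (λ (zR , pR) → zR ∷ pR) (picks-rest zW , picks-AllPairs pW))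

  picks-AllPairs-first : ∀ {R : A → A → Set} {V} → AllPairs R V →
                         AllPairs (R on proj₁) (picks V)
  picks-AllPairs-first []          = []
  picks-AllPairs-first (zW ∷ pW) = All.map⁺ (picks-first zW) ∷ AllPairs.map⁺ (picks-AllPairs-first pW)

  picks-length : ∀ V → All (λ p → suc (length (proj₂ p)) ≡ length V) (picks V)
  picks-length []      = []
  picks-length (z ∷ W) = ≡.refl ∷ All.map⁺ (All.map (≡.cong suc) (picks-length W))

  picks-↭ : ∀ V → All (λ p → V ↭ proj₁ p ∷ proj₂ p) (picks V)
  picks-↭ []      = []
  picks-↭ (z ∷ W) =
    ↭-refl ∷ All.map⁺ (All.map (λ W↭ → ↭-trans (↭-prep z W↭) (↭-swap z _ ↭-refl)) (picks-↭ W))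

  ∈-picks : ∀ {y V} → y ∈ V → ∃ λ R → (y , R) ∈ picks V
  ∈-picks {V = z ∷ W} (here ≡.refl) = W , here ≡.refl
  ∈-picks {V = z ∷ W} (there y∈W)   with ∈-picks y∈W
  ... | R , yR∈ = z ∷ R , there (∈-map⁺ _ yR∈)

module Permutations {A : Set} where
  open Picks {A}
  open ConcatMap

  permutations : ℕ → List A → List (List A)
  startingWith : ℕ → A × List A → List (List A)

  permutations zero    V = [] ∷ []
  permutations (suc n) V = concatMap (startingWith n) (picks V)

  startingWith n (y , R) = map (y ∷_) (permutations n R)

  private
    rest-length : ∀ {n V p} → length V ≡ suc n → p ∈ picks V → length (proj₂ p) ≡ n
    rest-length {V = V} len p∈ = ℕ.suc-injective (≡.trans (All.lookup (picks-length V) p∈) len)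

  permutations-sound : ∀ n V {w} → length V ≡ n → w ∈ permutations n V → w ↭ V
  permutations-sound zero    [] ≡.refl (here ≡.refl) = ↭-refl
  permutations-sound (suc n) V  len    w∈
    with ∈-concatMap⁻ (startingWith n) (picks V) w∈
  ... | (y , R) , yR∈ , yw∈ with ∈-map⁻ (y ∷_) yw∈
  ... | w , w∈ , ≡.refl =
    ↭-trans (↭-prep y (permutations-sound n R (rest-length len yR∈) w∈))
            (↭-sym (All.lookup (picks-↭ V) yR∈))

  permutations-complete : ∀ n V {w} → length V ≡ n → w ↭ V → w ∈ permutations n V
  permutations-complete zero    [] ≡.refl w↭[] rewrite ↭.↭-empty-inv w↭[] = here ≡.refl
  permutations-complete (suc n) V {[]} len []↭V with ≡.refl ← ↭.↭-empty-inv (↭-sym []↭V) with () ← len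
  permutations-complete (suc n) V {y ∷ w} len yw↭V
    with ∈-picks {y} {V} (↭.∈-resp-↭ yw↭V (here ≡.refl))
  ... | R , yR∈ = ∈-concatMap⁺ (startingWith n) yR∈ (∈-map⁺ (y ∷_)
    (permutations-complete n R (rest-length len yR∈)
      (↭.drop-∷ (↭-trans yw↭V (All.lookup (picks-↭ V) yR∈)))))

  permutations-unique : ∀ n V → length V ≡ n → Unique V → Unique (permutations n V)
  permutations-unique zero    V len uV = [] ∷ []
  permutations-unique (suc n) V len uV = concatMap-unique (startingWith n)
    (All.tabulate (λ {p} p∈ → Unique.map⁺ List.∷-injectiveʳ
      (permutations-unique n (proj₂ p) (rest-length len p∈) (All.lookup (picks-AllPairs uV) p∈))))
    (AllPairs.map disjoint (picks-AllPairs-first uV))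
    where
    disjoint : ∀ {p q} → proj₁ p ≢ proj₁ q → Disjoint (startingWith n p) (startingWith n q)
    disjoint {p} {q} p≢q (w∈p , w∈q) with ∈-map⁻ (proj₁ p ∷_) w∈p | ∈-map⁻ (proj₁ q ∷_) w∈q
    ... | _ , _ , w≡p | _ , _ , w≡q = p≢q (List.∷-injectiveˡ (≡.trans (≡.sym w≡p) w≡q))

_<ᵇ_ : ℤ → ℤ → Bool
y <ᵇ c = does (y ℤ.<? c)

if-< : ∀ {A : Set} {y c} {a b : A} → y ℤ.< c → (if y <ᵇ c then a else b) ≡ a
if-< {y = y} {c} y<c with y ℤ.<? c
... | yes _   = ≡.refl
... | no  y≮c = contradiction y<c y≮c

if-≮ : ∀ {A : Set} {y c} {a b : A} → ¬ y ℤ.< c → (if y <ᵇ c then a else b) ≡ b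
if-≮ {y = y} {c} y≮c with y ℤ.<? c
... | yes y<c = contradiction y<c y≮c
... | no  _   = ≡.refl

module Telescoping {ℓ} (R : CommutativeRing 0ℓ ℓ) where
  open CommutativeRing R
  open ListSum R
  open Picks {ℤ}
  open Exp semiring using (_^_)
  open GroupProperties +-group using () renaming (identityʳ-unique to +-identityʳ-unique)
  open CommutativeSemigroupProperties +-commutativeSemigroup using (xy∙z≈y∙zx)
  open CommutativeSemigroupProperties *-commutativeSemigroup using (x∙yz≈y∙xz)
  open SetoidReasoning setoid
  open NaturalSolver commutativeSemiring using (solve; _:=_; _:+_; _:*_)

  splitProd : Carrier → Carrier → ℤ → List ℤ → Carrier
  splitProd a b c V = ∏ (map (λ y → if y <ᵇ c then a else b) V)

  splitProd-≥ : ∀ a b {c} V → All (c ℤ.≤_) V → splitProd a b c V ≈ b ^ length V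
  splitProd-≥ a b []      []          = refl
  splitProd-≥ a b (y ∷ W) (c≤y ∷ c≤W) =
    *-cong (reflexive (if-≮ (ℤ.≤⇒≯ c≤y))) (splitProd-≥ a b W c≤W)

  splitProd-∷-< : ∀ a b {c z} W → z ℤ.< c → splitProd a b c (z ∷ W) ≈ a * splitProd a b c W
  splitProd-∷-< a b W z<c = *-cong (reflexive (if-< z<c)) refl

  splitProd-∷-≮ : ∀ a b {c z} W → ¬ z ℤ.< c → splitProd a b c (z ∷ W) ≈ b * splitProd a b c W
  splitProd-∷-≮ a b W z≮c = *-cong (reflexive (if-≮ z≮c)) refl

  if-≈ : ∀ (b : Bool) {x y z} → x ≈ z → y ≈ z → (if b then x else y) ≈ z
  if-≈ true  x≈z _   = x≈z
  if-≈ false _   y≈z = y≈z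

  splitProd-≈0 : ∀ {a b} c z W → a ≈ 0# → b ≈ 0# → splitProd a b c (z ∷ W) ≈ 0#
  splitProd-≈0 c z W a≈0 b≈0 = trans (*-cong (if-≈ (z <ᵇ c) a≈0 b≈0) refl) (zeroˡ _)

  ∑picks : (ℤ → List ℤ → Carrier) → List ℤ → Carrier
  ∑picks φ V = ∑ (map (uncurry φ) (picks V))

  ∑picks-∷ : ∀ φ s {z W} → All (z ℤ.<_) W →
             (∀ {y R} → z ℤ.< y → φ y (z ∷ R) ≈ s * φ y R) →
             ∑picks φ (z ∷ W) ≈ φ z W + s * ∑picks φ W
  ∑picks-∷ φ s {z} {W} z<W scale = +-cong refl (begin
    ∑ (map (uncurry φ) (map (map₂ (z ∷_)) (picks W)))  ≡⟨ ≡.cong ∑ (List.map-∘ (picks W)) ⟨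
    ∑ (map (uncurry φ ∘ map₂ (z ∷_)) (picks W))        ≈⟨ ∑-map-cong-All (All.map scale (picks-first z<W)) ⟩
    ∑ (map (λ p → s * uncurry φ p) (picks W))          ≈⟨ ∑-map-*ˡ (picks W) (uncurry φ) s ⟩
    s * ∑picks φ W                                     ∎)

  module _ {x u α : Carrier} (x+α≈u : x + α ≈ u) (c : ℤ) where

    belowPart : ℤ → List ℤ → Carrier
    belowPart y R = if y <ᵇ c then α * splitProd x u y R else 0#

    belowPart-scale : ∀ {z y R} → z ℤ.< y → belowPart y (z ∷ R) ≈ x * belowPart y R
    belowPart-scale {z} {y} {R} z<y with y ℤ.<? c
    ... | yes _ = trans (*-cong refl (splitProd-∷-< x u R z<y)) (x∙yz≈y∙xz α x _)
    ... | no  _ = sym (zeroʳ x)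

    telescope-below : ∀ V → AllPairs ℤ._<_ V →
                      splitProd x u c V + ∑picks belowPart V ≈ u ^ length V
    telescope-below []      []             = +-identityʳ 1#
    telescope-below (z ∷ W) (z<W ∷ sorted) = by-cases (z ℤ.<? c)
      where
      Π = splitProd x u c W ; S = ∑picks belowPart W ; w = length W
      Σ-split = ∑picks-∷ belowPart x z<W (λ {_} {R} → belowPart-scale {R = R})
      by-cases : Dec (z ℤ.< c) → splitProd x u c (z ∷ W) + ∑picks belowPart (z ∷ W) ≈ u * u ^ w
      by-cases (yes z<c) = begin
        splitProd x u c (z ∷ W) + ∑picks belowPart (z ∷ W)
          ≈⟨ +-cong (splitProd-∷-< x u W z<c) (trans Σ-split (+-cong (reflexive (if-< z<c)) refl)) ⟩
        x * Π + (α * splitProd x u z W + x * S)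
          ≈⟨ +-cong refl (+-cong (*-cong refl (splitProd-≥ x u W (All.map ℤ.<⇒≤ z<W))) refl) ⟩
        x * Π + (α * u ^ w + x * S)   ≈⟨ regroup x α Π S (u ^ w) ⟩
        x * (Π + S) + α * u ^ w       ≈⟨ +-cong (*-cong refl (telescope-below W sorted)) refl ⟩
        x * u ^ w + α * u ^ w         ≈⟨ distribʳ _ _ _ ⟨
        (x + α) * u ^ w               ≈⟨ *-cong x+α≈u refl ⟩
        u * u ^ w                     ∎
        where
        regroup : ∀ x α p t q → x * p + (α * q + x * t) ≈ x * (p + t) + α * q
        regroup = solve 5 (λ x α p t q → x :* p :+ (α :* q :+ x :* t) := x :* (p :+ t) :+ α :* q) refl
      by-cases (no z≮c) = begin
        splitProd x u c (z ∷ W) + ∑picks belowPart (z ∷ W)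
          ≈⟨ +-cong (splitProd-∷-≮ x u W z≮c) (trans Σ-split (+-cong (reflexive (if-≮ z≮c)) refl)) ⟩
        u * Π + (0# + x * S)
          ≈⟨ +-cong (*-cong refl Π≈uʷ) (+-cong refl (trans (*-cong refl S≈0) (zeroʳ x))) ⟩
        u * u ^ w + (0# + 0#)         ≈⟨ +-cong refl (+-identityʳ 0#) ⟩
        u * u ^ w + 0#                ≈⟨ +-identityʳ _ ⟩
        u * u ^ w                     ∎
        where
        Π≈uʷ : Π ≈ u ^ w
        Π≈uʷ = splitProd-≥ x u W (All.map (λ z<y → ℤ.<⇒≤ (ℤ.≤-<-trans (ℤ.≮⇒≥ z≮c) z<y)) z<W)
        S≈0 : S ≈ 0#
        S≈0 = +-identityʳ-unique Π S (trans (telescope-below W sorted) (sym Π≈uʷ))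

  module _ {u v β : Carrier} (u+β≈v : u + β ≈ v) (c : ℤ) where

    abovePart : ℤ → List ℤ → Carrier
    abovePart y R = if y <ᵇ c then 0# else β * splitProd u v y R

    abovePart-scale : ∀ {z y R} → z ℤ.< y → abovePart y (z ∷ R) ≈ u * abovePart y R
    abovePart-scale {z} {y} {R} z<y with y ℤ.<? c
    ... | yes _ = sym (zeroʳ u)
    ... | no  _ = trans (*-cong refl (splitProd-∷-< u v R z<y)) (x∙yz≈y∙xz β u _)

    telescope-above : ∀ V → AllPairs ℤ._<_ V →
                      ∑picks abovePart V + u ^ length V ≈ splitProd u v c V
    telescope-above []      []             = +-identityˡ 1#
    telescope-above (z ∷ W) (z<W ∷ sorted) = by-cases (z ℤ.<? c)
      where
      A = ∑picks abovePart W ; w = length W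
      Σ-split = ∑picks-∷ abovePart u z<W (λ {_} {R} → abovePart-scale {R = R})
      by-cases : Dec (z ℤ.< c) → ∑picks abovePart (z ∷ W) + u * u ^ w ≈ splitProd u v c (z ∷ W)
      by-cases (yes z<c) = begin
        ∑picks abovePart (z ∷ W) + u * u ^ w
          ≈⟨ +-cong (trans Σ-split (+-cong (reflexive (if-< z<c)) refl)) refl ⟩
        (0# + u * A) + u * u ^ w              ≈⟨ +-cong (+-identityˡ _) refl ⟩
        u * A + u * u ^ w                     ≈⟨ distribˡ _ _ _ ⟨
        u * (A + u ^ w)                       ≈⟨ *-cong refl (telescope-above W sorted) ⟩
        u * splitProd u v c W                 ≈⟨ splitProd-∷-< u v W z<c ⟨
        splitProd u v c (z ∷ W)               ∎
      by-cases (no z≮c) = begin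
        ∑picks abovePart (z ∷ W) + u * u ^ w
          ≈⟨ +-cong (trans Σ-split (+-cong (reflexive (if-≮ z≮c)) refl)) refl ⟩
        (β * splitProd u v z W + u * A) + u * u ^ w
          ≈⟨ +-cong (+-cong (*-cong refl (splitProd-≥ u v W (All.map ℤ.<⇒≤ z<W))) refl) refl ⟩
        (β * v ^ w + u * A) + u * u ^ w       ≈⟨ regroup β (v ^ w) u A (u ^ w) ⟩
        β * v ^ w + u * (A + u ^ w)
          ≈⟨ +-cong refl (*-cong refl (trans (telescope-above W sorted) Π≈vʷ)) ⟩
        β * v ^ w + u * v ^ w                 ≈⟨ distribʳ _ _ _ ⟨
        (β + u) * v ^ w                       ≈⟨ *-cong (trans (+-comm β u) u+β≈v) (sym Π≈vʷ) ⟩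
        v * splitProd u v c W                 ≈⟨ splitProd-∷-≮ u v W z≮c ⟨
        splitProd u v c (z ∷ W)               ∎
        where
        Π≈vʷ : splitProd u v c W ≈ v ^ w
        Π≈vʷ = splitProd-≥ u v W (All.map (λ z<y → ℤ.<⇒≤ (ℤ.≤-<-trans (ℤ.≮⇒≥ z≮c) z<y)) z<W)
        regroup : ∀ b q u t p → (b * q + u * t) + u * p ≈ b * q + u * (t + p)
        regroup = solve 5 (λ b q u t p → (b :* q :+ u :* t) :+ u :* p := b :* q :+ u :* (t :+ p)) refl

  -- If r of the m letters of V lie below c, the picks below c contribute u^r u^(m-r) - x^r u^(m-r)
  -- and the picks above c contribute u^r v^(m-r) - u^r u^(m-r).
  telescope : ∀ {x u v α β} → x + α ≈ u → u + β ≈ v → ∀ c V → AllPairs ℤ._<_ V →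
    ∑picks (λ y R → if y <ᵇ c then α * splitProd x u y R else β * splitProd u v y R) V
      + splitProd x u c V ≈ splitProd u v c V
  telescope {x} {u} {v} {α} {β} x+α≈u u+β≈v c V sorted = begin
    ∑picks term V + splitProd x u c V
      ≈⟨ +-cong (trans (∑-map-cong (picks V) (uncurry split)) (∑-map-+ (picks V) _ _)) refl ⟩
    (B + A) + splitProd x u c V           ≈⟨ xy∙z≈y∙zx B A _ ⟩
    A + (splitProd x u c V + B)           ≈⟨ +-cong refl (telescope-below x+α≈u c V sorted) ⟩
    A + u ^ length V                      ≈⟨ telescope-above u+β≈v c V sorted ⟩
    splitProd u v c V                     ∎
    where
    term : ℤ → List ℤ → Carrier
    term y R = if y <ᵇ c then α * splitProd x u y R else β * splitProd u v y R
    B = ∑picks (belowPart x+α≈u c) V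
    A = ∑picks (abovePart u+β≈v c) V
    split : ∀ y R → term y R ≈ belowPart x+α≈u c y R + abovePart u+β≈v c y R
    split y R with y ℤ.<? c
    ... | yes _ = sym (+-identityʳ _)
    ... | no  _ = sym (+-identityˡ _)

applyUpTo-cong : ∀ {A : Set} {f g : ℕ → A} n → (∀ j → f j ≡ g j) → applyUpTo f n ≡ applyUpTo g n
applyUpTo-cong zero    f≡g = ≡.refl
applyUpTo-cong (suc n) f≡g = ≡.cong₂ _∷_ (f≡g 0) (applyUpTo-cong n (f≡g ∘ suc))

record QIntegers {ℓ} (R : CommutativeRing 0ℓ ℓ) : Set ℓ where
  open CommutativeRing R
  field
    q^_     : ℕ → Carrier
    [_]     : ℕ → Carrier
    q^-zero : q^ 0 ≈ 1#
    q^-+    : ∀ a b → q^ (a ℕ.+ b) ≈ q^ a * q^ b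
    [0]     : [ 0 ] ≈ 0#
    [suc]   : ∀ k → [ suc k ] ≈ [ k ] + q^ k

module Carlitz {ℓ} {R : CommutativeRing 0ℓ ℓ} (Q : QIntegers R) where
  open CommutativeRing R
  open QIntegers Q
  open ListSum R
  open PowerSeries R
  open Telescoping R
  open Picks {ℤ}
  open Permutations {ℤ}
  module ∑ₛ = ListSum ⊕-⊗-commutativeRing
  open GroupProperties +-group using (x≈z//y)
  module ≈-Reasoning = SetoidReasoning setoid

  q^-cong : ∀ {a b} → a ≡ b → q^ a ≈ q^ b
  q^-cong a≡b = reflexive (≡.cong q^_ a≡b)

  q^-+-* : ∀ a b x → q^ (a ℕ.+ b) * x ≈ q^ a * (q^ b * x)
  q^-+-* a b x = trans (*-cong (q^-+ a b) refl) (*-assoc _ _ _)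

  qtMonomial : List ℕ → Ser
  qtMonomial D = monoS (q^ (foldr ℕ._+_ 0 D)) (length D)

  descentMonomial : ℕ → ℤ → List ℤ → Ser
  descentMonomial i c = qtMonomial ∘ descentsFrom i c

  descentSeries : ℕ → ℤ → List (List ℤ) → Ser
  descentSeries i c ws = sumS (map (descentMonomial i c) ws)

  descentFactor : ℕ → ℤ → ℤ → Ser
  descentFactor i c y = if y <ᵇ c then monoS (q^ i) 1 else oneS

  descentMonomial-∷ : ∀ i c y w →
                      descentMonomial i c (y ∷ w) ≋ descentFactor i c y ⊗ descentMonomial (suc i) y w
  descentMonomial-∷ i c y w = by-cases (y ℤ.<? c)
    where
    ds = descentsFrom (suc i) y w
    open ≋-Reasoning
    by-cases : Dec (y ℤ.< c) → descentMonomial i c (y ∷ w) ≋ descentFactor i c y ⊗ qtMonomial ds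
    by-cases (yes y<c) = begin
      descentMonomial i c (y ∷ w)                             ≡⟨ ≡.cong qtMonomial (if-< y<c) ⟩
      monoS (q^ (i ℕ.+ foldr ℕ._+_ 0 ds)) (suc (length ds))   ≈⟨ monoS-cong _ (q^-+ i _) ⟩
      monoS (q^ i * q^ (foldr ℕ._+_ 0 ds)) (1 ℕ.+ length ds)  ≈⟨ monoS-⊗-monoS (q^ i) 1 _ _ ⟨
      monoS (q^ i) 1 ⊗ qtMonomial ds                          ≡⟨ ≡.cong (_⊗ qtMonomial ds) (if-< y<c) ⟨
      descentFactor i c y ⊗ qtMonomial ds                     ∎
    by-cases (no y≮c) = begin
      descentMonomial i c (y ∷ w)            ≡⟨ ≡.cong qtMonomial (if-≮ y≮c) ⟩
      qtMonomial ds                          ≈⟨ ⊗-identityˡ (qtMonomial ds) ⟨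
      oneS ⊗ qtMonomial ds                   ≡⟨ ≡.cong (_⊗ qtMonomial ds) (if-≮ y≮c) ⟨
      descentFactor i c y ⊗ qtMonomial ds    ∎

  descentSeries-map-∷ : ∀ i c y ws →
    descentSeries i c (map (y ∷_) ws) ≋ descentFactor i c y ⊗ descentSeries (suc i) y ws
  descentSeries-map-∷ i c y ws = begin
    sumS (map (descentMonomial i c) (map (y ∷_) ws))     ≡⟨ ≡.cong sumS (List.map-∘ ws) ⟨
    sumS (map (descentMonomial i c ∘ (y ∷_)) ws)         ≈⟨ ∑ₛ.∑-map-cong ws (descentMonomial-∷ i c y) ⟩
    sumS (map (λ w → descentFactor i c y ⊗ descentMonomial (suc i) y w) ws)
      ≈⟨ ∑ₛ.∑-map-*ˡ ws (descentMonomial (suc i) y) (descentFactor i c y) ⟩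
    descentFactor i c y ⊗ descentSeries (suc i) y ws     ∎
    where open ≋-Reasoning

  bracketProd : ℕ → ℤ → List ℤ → Carrier
  bracketProd k = splitProd [ k ] [ suc k ]

  boxSeries : ℕ → ℤ → List ℤ → Ser
  boxSeries i c V k = q^ (i ℕ.* k) * bracketProd k c V

  denominator : ℕ → ℕ → Ser
  denominator i n = prodS (map (λ j → 1- q^ j ·t) (applyUpTo (i ℕ.+_) (suc n)))

  denominator-constant : ∀ i n → denominator i n 0 ≈ 1#
  denominator-constant i n =
    prodS-zero _ (All.map⁺ (All.universal (λ j → [1-·t]-zero (q^ j)) (applyUpTo (i ℕ.+_) (suc n))))

  denominator-zero : ∀ i → denominator i 0 ≋ 1- q^ i ·t
  denominator-zero i =
    ≋-trans (≡⇒≋ (≡.cong (λ j → (1- q^ j ·t) ⊗ oneS) (ℕ.+-identityʳ i))) (⊗-identityʳ _)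

  denominator-suc : ∀ i n → denominator i (suc n) ≋ (1- q^ i ·t) ⊗ denominator (suc i) n
  denominator-suc i n = ≡⇒≋ (≡.cong₂ (λ j js → (1- q^ j ·t) ⊗ prodS (map (λ j → 1- q^ j ·t) js))
    (ℕ.+-identityʳ i) (applyUpTo-cong (suc n) (ℕ.+-suc i)))

  boxSeries-[]-⊗ : ∀ i c → boxSeries i c [] ⊗ (1- q^ i ·t) ≋ oneS
  boxSeries-[]-⊗ i c zero    =
    trans (⊗-[1-·t]-zero (q^ i) (boxSeries i c [])) (trans (*-identityʳ _) (trans (q^-cong (ℕ.*-zeroʳ i)) q^-zero))
  boxSeries-[]-⊗ i c (suc k) = begin
    (boxSeries i c [] ⊗ (1- q^ i ·t)) (suc k)       ≈⟨ ⊗-[1-·t]-suc (q^ i) (boxSeries i c []) k ⟩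
    q^ (i ℕ.* suc k) * 1# - q^ i * (q^ (i ℕ.* k) * 1#)
      ≈⟨ +-cong refl (-‿cong (trans (*-cong (q^-cong (ℕ.*-suc i k)) refl) (q^-+-* i (i ℕ.* k) 1#))) ⟨
    q^ (i ℕ.* suc k) * 1# - q^ (i ℕ.* suc k) * 1#  ≈⟨ -‿inverseʳ _ ⟩
    0#                                              ∎
    where open ≈-Reasoning

  pickSeries : ℕ → ℤ → ℤ × List ℤ → Ser
  pickSeries i c (y , R) = descentFactor i c y ⊗ boxSeries (suc i) y R

  pickSeries-zero : ∀ i c y R → pickSeries i c (y , R) 0 ≈
    (if y <ᵇ c then 0# * splitProd 0# [ 0 ] y R else q^ 0 * bracketProd 0 y R)
  pickSeries-zero i c y R = by-cases (y ℤ.<? c)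
    where
    open ≈-Reasoning
    X = boxSeries (suc i) y R
    term : Carrier
    term = if y <ᵇ c then 0# * splitProd 0# [ 0 ] y R else q^ 0 * bracketProd 0 y R
    by-cases : Dec (y ℤ.< c) → (descentFactor i c y ⊗ X) 0 ≈ term
    by-cases (yes y<c) = begin
      (descentFactor i c y ⊗ X) 0   ≡⟨ ≡.cong (λ f → (f ⊗ X) 0) (if-< y<c) ⟩
      (monoS (q^ i) 1 ⊗ X) 0        ≈⟨ monoS-suc-⊗-zero (q^ i) 0 X ⟩
      0#                            ≈⟨ zeroˡ _ ⟨
      0# * splitProd 0# [ 0 ] y R   ≡⟨ if-< y<c ⟨
      term                          ∎
    by-cases (no y≮c) = begin
      (descentFactor i c y ⊗ X) 0           ≡⟨ ≡.cong (λ f → (f ⊗ X) 0) (if-≮ y≮c) ⟩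
      (oneS ⊗ X) 0                          ≈⟨ ⊗-identityˡ X 0 ⟩
      q^ (suc i ℕ.* 0) * bracketProd 0 y R  ≈⟨ *-cong (q^-cong (ℕ.*-zeroʳ (suc i))) refl ⟩
      q^ 0 * bracketProd 0 y R              ≡⟨ if-≮ y≮c ⟨
      term                                  ∎

  pickSeries-suc : ∀ i c y R k → pickSeries i c (y , R) (suc k) ≈ q^ (i ℕ.* suc k) *
    (if y <ᵇ c then q^ k * bracketProd k y R else q^ (suc k) * bracketProd (suc k) y R)
  pickSeries-suc i c y R k = by-cases (y ℤ.<? c)
    where
    open ≈-Reasoning
    X = boxSeries (suc i) y R
    term : Carrier
    term = if y <ᵇ c then q^ k * bracketProd k y R else q^ (suc k) * bracketProd (suc k) y R
    exponent : ∀ i k → i ℕ.+ (k ℕ.+ i ℕ.* k) ≡ i ℕ.* suc k ℕ.+ k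
    exponent = solve-∀
    by-cases : Dec (y ℤ.< c) → (descentFactor i c y ⊗ X) (suc k) ≈ q^ (i ℕ.* suc k) * term
    by-cases (yes y<c) = begin
      (descentFactor i c y ⊗ X) (suc k)     ≡⟨ ≡.cong (λ f → (f ⊗ X) (suc k)) (if-< y<c) ⟩
      (monoS (q^ i) 1 ⊗ X) (suc k)          ≈⟨ monoS-suc-⊗-suc (q^ i) 0 X k ⟩
      (monoS (q^ i) 0 ⊗ X) k                ≈⟨ monoS-zero-⊗ (q^ i) X k ⟩
      q^ i * (q^ (suc i ℕ.* k) * bracketProd k y R)   ≈⟨ q^-+-* i _ _ ⟨
      q^ (i ℕ.+ suc i ℕ.* k) * bracketProd k y R      ≈⟨ *-cong (q^-cong (exponent i k)) refl ⟩
      q^ (i ℕ.* suc k ℕ.+ k) * bracketProd k y R      ≈⟨ q^-+-* (i ℕ.* suc k) k _ ⟩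
      q^ (i ℕ.* suc k) * (q^ k * bracketProd k y R)   ≡⟨ ≡.cong (q^ (i ℕ.* suc k) *_) (if-< y<c) ⟨
      q^ (i ℕ.* suc k) * term                         ∎
    by-cases (no y≮c) = begin
      (descentFactor i c y ⊗ X) (suc k)     ≡⟨ ≡.cong (λ f → (f ⊗ X) (suc k)) (if-≮ y≮c) ⟩
      (oneS ⊗ X) (suc k)                    ≈⟨ ⊗-identityˡ X (suc k) ⟩
      q^ (suc k ℕ.+ i ℕ.* suc k) * bracketProd (suc k) y R
        ≈⟨ *-cong (q^-cong (ℕ.+-comm (suc k) (i ℕ.* suc k))) refl ⟩
      q^ (i ℕ.* suc k ℕ.+ suc k) * bracketProd (suc k) y R
        ≈⟨ q^-+-* (i ℕ.* suc k) (suc k) _ ⟩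
      q^ (i ℕ.* suc k) * (q^ (suc k) * bracketProd (suc k) y R)
        ≡⟨ ≡.cong (q^ (i ℕ.* suc k) *_) (if-≮ y≮c) ⟨
      q^ (i ℕ.* suc k) * term               ∎

  -- Coefficientwise this is `telescope` for [k], [k+1], [k+2]; at t^0 the missing [-1] is 0.
  ∑picks-pickSeries : ∀ i c z W → AllPairs ℤ._<_ (z ∷ W) →
    sumS (map (pickSeries i c) (picks (z ∷ W))) ≋ boxSeries i c (z ∷ W) ⊗ (1- q^ i ·t)
  ∑picks-pickSeries i c z W sorted zero = begin
    sumS (map (pickSeries i c) (picks V)) 0      ≈⟨ sumS-coeff (picks V) (pickSeries i c) 0 ⟩
    ∑ (map (λ p → pickSeries i c p 0) (picks V))
      ≈⟨ ∑-map-cong (picks V) (λ (y , R) → pickSeries-zero i c y R) ⟩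
    ∑picks term V                                ≈⟨ +-identityʳ _ ⟨
    ∑picks term V + 0#                           ≈⟨ +-cong refl (splitProd-≈0 c z W refl [0]) ⟨
    ∑picks term V + splitProd 0# [ 0 ] c V
      ≈⟨ telescope (trans (+-identityʳ 0#) (sym [0])) (sym ([suc] 0)) c V sorted ⟩
    bracketProd 0 c V                            ≈⟨ *-identityˡ _ ⟨
    1# * bracketProd 0 c V                       ≈⟨ *-cong (trans (q^-cong (ℕ.*-zeroʳ i)) q^-zero) refl ⟨
    boxSeries i c V 0                            ≈⟨ ⊗-[1-·t]-zero (q^ i) (boxSeries i c V) ⟨
    (boxSeries i c V ⊗ (1- q^ i ·t)) 0           ∎
    where
    open ≈-Reasoning
    V = z ∷ W
    term : ℤ → List ℤ → Carrier
    term y R = if y <ᵇ c then 0# * splitProd 0# [ 0 ] y R else q^ 0 * bracketProd 0 y R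
  ∑picks-pickSeries i c z W sorted (suc k) = begin
    sumS (map (pickSeries i c) (picks V)) (suc k)      ≈⟨ sumS-coeff (picks V) (pickSeries i c) (suc k) ⟩
    ∑ (map (λ p → pickSeries i c p (suc k)) (picks V))
      ≈⟨ ∑-map-cong (picks V) (λ (y , R) → pickSeries-suc i c y R k) ⟩
    ∑ (map (λ p → q^ (i ℕ.* suc k) * uncurry term p) (picks V))
      ≈⟨ ∑-map-*ˡ (picks V) (uncurry term) _ ⟩
    q^ (i ℕ.* suc k) * ∑picks term V
      ≈⟨ x≈z//y _ _ _ (trans (sym (distribˡ _ _ _)) (*-cong refl telescoped)) ⟩
    q^ (i ℕ.* suc k) * bracketProd (suc k) c V - q^ (i ℕ.* suc k) * bracketProd k c V
      ≈⟨ +-cong refl (-‿cong (trans (*-cong (q^-cong (ℕ.*-suc i k)) refl) (q^-+-* i (i ℕ.* k) _))) ⟩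
    boxSeries i c V (suc k) - q^ i * boxSeries i c V k ≈⟨ ⊗-[1-·t]-suc (q^ i) (boxSeries i c V) k ⟨
    (boxSeries i c V ⊗ (1- q^ i ·t)) (suc k)           ∎
    where
    open ≈-Reasoning
    V = z ∷ W
    term : ℤ → List ℤ → Carrier
    term y R = if y <ᵇ c then q^ k * bracketProd k y R else q^ (suc k) * bracketProd (suc k) y R
    telescoped : ∑picks term V + bracketProd k c V ≈ bracketProd (suc k) c V
    telescoped = telescope (sym ([suc] k)) (sym ([suc] (suc k))) c V sorted

  descentSeries-permutations : ∀ n i c V → length V ≡ n → AllPairs ℤ._<_ V →
    descentSeries i c (permutations n V) ≋ boxSeries i c V ⊗ denominator i n
  descentSeries-permutations zero i c [] ≡.refl [] = begin
    descentSeries i c ([] ∷ [])         ≈⟨ (λ k → +-identityʳ _) ⟩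
    monoS (q^ 0) 0                      ≈⟨ monoS-cong 0 q^-zero ⟩
    monoS 1# 0                          ≈⟨ monoS-one ⟩
    oneS                                ≈⟨ boxSeries-[]-⊗ i c ⟨
    boxSeries i c [] ⊗ (1- q^ i ·t)     ≈⟨ ⊗-congˡ (boxSeries i c []) (denominator-zero i) ⟨
    boxSeries i c [] ⊗ denominator i 0  ∎
    where open ≋-Reasoning
  descentSeries-permutations (suc n) i c (z ∷ W) len sorted = begin
    descentSeries i c (permutations (suc n) V)
      ≈⟨ ∑ₛ.∑-concatMap (picks V) (startingWith n) (descentMonomial i c) ⟩
    sumS (map (λ p → descentSeries i c (startingWith n p)) (picks V))
      ≈⟨ ∑ₛ.∑-map-cong-All (All.tabulate first-letter) ⟩
    sumS (map (λ p → pickSeries i c p ⊗ denominator (suc i) n) (picks V))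
      ≈⟨ ∑ₛ.∑-map-*ʳ (picks V) (pickSeries i c) (denominator (suc i) n) ⟩
    sumS (map (pickSeries i c) (picks V)) ⊗ denominator (suc i) n
      ≈⟨ ⊗-congʳ (denominator (suc i) n) (∑picks-pickSeries i c z W sorted) ⟩
    (boxSeries i c V ⊗ (1- q^ i ·t)) ⊗ denominator (suc i) n
      ≈⟨ ⊗-assoc (boxSeries i c V) (1- q^ i ·t) (denominator (suc i) n) ⟩
    boxSeries i c V ⊗ ((1- q^ i ·t) ⊗ denominator (suc i) n)
      ≈⟨ ⊗-congˡ (boxSeries i c V) (denominator-suc i n) ⟨
    boxSeries i c V ⊗ denominator i (suc n) ∎
    where
    open ≋-Reasoning
    V = z ∷ W
    first-letter : ∀ {p} → p ∈ picks V →
                   descentSeries i c (startingWith n p) ≋ pickSeries i c p ⊗ denominator (suc i) n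
    first-letter {y , R} yR∈ = begin
      descentSeries i c (map (y ∷_) (permutations n R))
        ≈⟨ descentSeries-map-∷ i c y (permutations n R) ⟩
      descentFactor i c y ⊗ descentSeries (suc i) y (permutations n R)
        ≈⟨ ⊗-congˡ (descentFactor i c y) (descentSeries-permutations n (suc i) y R R-length R-sorted) ⟩
      descentFactor i c y ⊗ (boxSeries (suc i) y R ⊗ denominator (suc i) n)
        ≈⟨ ⊗-assoc (descentFactor i c y) (boxSeries (suc i) y R) (denominator (suc i) n) ⟨
      pickSeries i c (y , R) ⊗ denominator (suc i) n ∎
      where
      R-length = ℕ.suc-injective (≡.trans (All.lookup (picks-length V) yR∈) len)
      R-sorted = All.lookup (picks-AllPairs sorted) yR∈

module SignedPermutations where
  open Picks {ℤ}
  open Permutations {ℤ}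
  open ConcatMap

  -- signSets n lists, as increasing lists, the 2^n choices of one of ±j for each j ≤ n.
  extendSigns : ℕ → List ℤ → List (List ℤ)
  extendSigns n V = (-[1+ n ] ∷ V) ∷ (V ++ + suc n ∷ []) ∷ []

  signSets : ℕ → List (List ℤ)
  signSets zero    = [] ∷ []
  signSets (suc n) = concatMap (extendSigns n) (signSets n)

  signedPermutations : ℕ → List (List ℤ)
  signedPermutations n = concatMap (permutations n) (signSets n)

  InRange : ℕ → ℤ → Set
  InRange n y = -[1+ n ] ℤ.< y × y ℤ.< + suc n

  record IsSignSet (n : ℕ) (V : List ℤ) : Set where
    field
      sorted  : AllPairs ℤ._<_ V
      length≡ : length V ≡ n
      inRange : All (InRange n) V
      abs↭    : map ∣_∣ V ↭ map suc (upTo n)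

  map-suc-upTo-suc : ∀ n → map suc (upTo n) ++ suc n ∷ [] ≡ map suc (upTo (suc n))
  map-suc-upTo-suc n = ≡.trans (≡.sym (List.map-++ suc (upTo n) (n ∷ []))) (≡.cong (map suc) (List.upTo-∷ʳ n))

  map-suc-upTo-↭ : ∀ n → map suc (upTo (suc n)) ↭ suc n ∷ map suc (upTo n)
  map-suc-upTo-↭ n = ≡.subst (_↭ suc n ∷ map suc (upTo n)) (map-suc-upTo-suc n)
                       (↭.++-comm (map suc (upTo n)) (suc n ∷ []))

  inRange-suc : ∀ {n y} → InRange n y → InRange (suc n) y
  inRange-suc {n} (lower , upper) =
    ℤ.<-trans (ℤ.-<- (ℕ.n<1+n n)) lower , ℤ.<-trans upper (ℤ.+<+ (ℕ.n<1+n (suc n)))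

  signSets-IsSignSet : ∀ n {V} → V ∈ signSets n → IsSignSet n V
  signSets-IsSignSet zero    (here ≡.refl) = record
    { sorted = [] ; length≡ = ≡.refl ; inRange = [] ; abs↭ = ↭-refl }
  signSets-IsSignSet (suc n) V∈ with ∈-concatMap⁻ (extendSigns n) (signSets n) V∈
  ... | V , V∈ , here ≡.refl = record
    { sorted  = All.map proj₁ inRange ∷ sorted
    ; length≡ = ≡.cong suc length≡
    ; inRange = (ℤ.-<- (ℕ.n<1+n n) , ℤ.-<+) ∷ All.map inRange-suc inRange
    ; abs↭    = ↭-trans (↭-prep (suc n) abs↭) (↭-sym (map-suc-upTo-↭ n)) }
    where open IsSignSet (signSets-IsSignSet n V∈)
  ... | V , V∈ , there (here ≡.refl) = record
    { sorted  = AllPairs.++⁺ sorted ([] ∷ []) (All.map (λ y<n+1 → proj₂ y<n+1 ∷ []) inRange)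
    ; length≡ = ≡.trans (List.length-++ V) (≡.trans (ℕ.+-comm (length V) 1) (≡.cong suc length≡))
    ; inRange = All.++⁺ (All.map inRange-suc inRange) ((ℤ.-<+ , ℤ.+<+ (ℕ.n<1+n (suc n))) ∷ [])
    ; abs↭    = ≡.subst₂ _↭_ (≡.sym (List.map-++ ∣_∣ V (+ suc n ∷ []))) (map-suc-upTo-suc n)
                  (↭.++⁺ʳ (suc n ∷ []) abs↭) }
    where open IsSignSet (signSets-IsSignSet n V∈)

  -∷≢+++ : ∀ {n V V′} → All (InRange n) V → -[1+ n ] ∷ V ≢ V′ ++ + suc n ∷ []
  -∷≢+++ {n} {V} {V′} inRange eq with ≡.subst (+ suc n ∈_) (≡.sym eq) (∈-++⁺ʳ V′ (here ≡.refl))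
  ... | there n+1∈V = ℤ.<-irrefl ≡.refl (proj₂ (All.lookup inRange n+1∈V))

  signSets-unique : ∀ n → Unique (signSets n)
  signSets-unique zero    = [] ∷ []
  signSets-unique (suc n) = concatMap-unique (extendSigns n)
    (All.tabulate (λ V∈ → (-∷≢+++ (IsSignSet.inRange (signSets-IsSignSet n V∈)) ∷ []) ∷ [] ∷ []))
    (AllPairs.map disjoint (allPairs-both (All.tabulate (signSets-IsSignSet n)) (signSets-unique n)))
    where
    disjoint : ∀ {V V′} → IsSignSet n V × IsSignSet n V′ × V ≢ V′ →
               Disjoint (extendSigns n V) (extendSigns n V′)
    disjoint (_ , _ , V≢V′) (here e , here e′) =
      V≢V′ (List.∷-injectiveʳ (≡.trans (≡.sym e) e′))
    disjoint {V} {V′} (_ , _ , V≢V′) (there (here e) , there (here e′)) =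
      V≢V′ (proj₁ (List.∷ʳ-injective V V′ (≡.trans (≡.sym e) e′)))
    disjoint (s , _ , _) (here e , there (here e′)) =
      -∷≢+++ (IsSignSet.inRange s) (≡.trans (≡.sym e) e′)
    disjoint (_ , s′ , _) (there (here e) , here e′) =
      -∷≢+++ (IsSignSet.inRange s′) (≡.trans (≡.sym e′) e)
    disjoint _ (there (there ()) , _)
    disjoint _ (_ , there (there ()))

  ∣∣-drop-middle : ∀ {m M} as y bs → map ∣_∣ (as ++ y ∷ bs) ↭ m ∷ M → m ≡ ∣ y ∣ →
                  map ∣_∣ (as ++ bs) ↭ M
  ∣∣-drop-middle as y bs |w|↭ ≡.refl = ↭.drop-∷ (↭-trans (↭-sym (↭.map⁺ ∣_∣ (↭.shift y as bs))) |w|↭)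

  insertSign : ∀ {n} as y bs → suc n ≡ ∣ y ∣ → ∃ (λ V → V ∈ signSets n × as ++ bs ↭ V) →
               ∃ λ V′ → V′ ∈ signSets (suc n) × as ++ y ∷ bs ↭ V′
  insertSign {n} as (+ _)     bs ≡.refl (V , V∈ , as++bs↭V) =
    V ++ + suc n ∷ [] , ∈-concatMap⁺ (extendSigns n) V∈ (there (here ≡.refl)) ,
    ↭-trans (↭.shift (+ suc n) as bs) (↭-trans (↭-prep (+ suc n) as++bs↭V) (↭.++-comm (+ suc n ∷ []) V))
  insertSign {n} as -[1+ _ ] bs ≡.refl (V , V∈ , as++bs↭V) =
    -[1+ n ] ∷ V , ∈-concatMap⁺ (extendSigns n) V∈ (here ≡.refl) ,
    ↭-trans (↭.shift -[1+ n ] as bs) (↭-prep -[1+ n ] as++bs↭V)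

  signSets-complete : ∀ n w → map ∣_∣ w ↭ map suc (upTo n) → ∃ λ V → V ∈ signSets n × w ↭ V
  signSets-complete zero    []      _      = [] , here ≡.refl , ↭-refl
  signSets-complete zero    (y ∷ w) |w|↭[] with () ← ↭.↭-empty-inv |w|↭[]
  signSets-complete (suc n) w       |w|↭
    with ∈-map⁻ ∣_∣ (↭.∈-resp-↭ (↭-sym (↭-trans |w|↭ (map-suc-upTo-↭ n))) (here ≡.refl))
  ... | y , y∈w , n+1≡|y| with ∈-∃++ y∈w
  ... | as , bs , ≡.refl = insertSign as y bs n+1≡|y| (signSets-complete n (as ++ bs)
    (∣∣-drop-middle as y bs (↭-trans |w|↭ (map-suc-upTo-↭ n)) n+1≡|y|))

  signedPermutations-sound : ∀ n {w} → w ∈ signedPermutations n → IsSignedPerm n w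
  signedPermutations-sound n w∈ with V , V∈ , w∈V! ← ∈-concatMap⁻ (permutations n) (signSets n) w∈ =
    ↭-trans (↭.map⁺ ∣_∣ (permutations-sound n V length≡ w∈V!)) abs↭
    where open IsSignSet (signSets-IsSignSet n V∈)

  signedPermutations-complete : ∀ n {w} → IsSignedPerm n w → w ∈ signedPermutations n
  signedPermutations-complete n {w} |w|↭ with V , V∈ , w↭V ← signSets-complete n w |w|↭ =
    ∈-concatMap⁺ (permutations n) V∈ (permutations-complete n V length≡ w↭V)
    where open IsSignSet (signSets-IsSignSet n V∈)

  signedPermutations-unique : ∀ n → Unique (signedPermutations n)
  signedPermutations-unique n = concatMap-unique (permutations n)
    (All.tabulate (λ V∈ → let open IsSignSet (signSets-IsSignSet n V∈) in
      permutations-unique n _ length≡ (AllPairs.map ℤ.<⇒≢ sorted)))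
    (AllPairs.map disjoint (allPairs-both (All.tabulate (signSets-IsSignSet n)) (signSets-unique n)))
    where
    sorted-↭⇒≡ : ∀ {V V′} → AllPairs ℤ._<_ V → AllPairs ℤ._<_ V′ → V ↭ V′ → V ≡ V′
    sorted-↭⇒≡ V↗ V′↗ V↭V′ = Pointwise-≡⇒≡ (↗↭↗⇒≋ ℤ.≤-totalOrder
      (AllPairs⇒Linked (AllPairs.map ℤ.<⇒≤ V↗)) (AllPairs⇒Linked (AllPairs.map ℤ.<⇒≤ V′↗)) (↭⇒↭ₛ V↭V′))
    disjoint : ∀ {V V′} → IsSignSet n V × IsSignSet n V′ × V ≢ V′ →
               Disjoint (permutations n V) (permutations n V′)
    disjoint {V} {V′} (s , s′ , V≢V′) (w∈V! , w∈V′!) = V≢V′ (sorted-↭⇒≡ (IsSignSet.sorted s) (IsSignSet.sorted s′)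
      (↭-trans (↭-sym (permutations-sound n V (IsSignSet.length≡ s) w∈V!))
               (permutations-sound n V′ (IsSignSet.length≡ s′) w∈V′!)))

  ↭-signedPermutations : ∀ n L → Unique L → (∀ w → (w ∈ L) ⇔ IsSignedPerm n w) →
                         L ↭ signedPermutations n
  ↭-signedPermutations n L unique L⇔B = ∼bag⇒↭ (unique∧set⇒bag unique (signedPermutations-unique n)
    (λ {w} → mk⇔ (signedPermutations-complete n ∘ Equivalence.to (L⇔B w))
                 (Equivalence.from (L⇔B w) ∘ signedPermutations-sound n)))

module TypeB {ℓ} {R : CommutativeRing 0ℓ ℓ} (Q : QIntegers R) where
  open CommutativeRing R
  open QIntegers Q
  open ListSum R
  open PowerSeries R
  open Carlitz Q
  open SignedPermutations
  open Exp semiring using (_^_)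
  open NaturalSolver commutativeSemiring using (solve; _:=_; _:+_; _:*_; con)

  ∑-bracketProd-signSets : ∀ n k → ∑ (map (bracketProd k (+ 0)) (signSets n)) ≈ ([ suc k ] + [ k ]) ^ n
  ∑-bracketProd-signSets zero    k = +-identityʳ 1#
  ∑-bracketProd-signSets (suc n) k = begin
    ∑ (map (bracketProd k (+ 0)) (concatMap (extendSigns n) (signSets n)))
      ≈⟨ ∑-concatMap (signSets n) (extendSigns n) (bracketProd k (+ 0)) ⟩
    ∑ (map (λ V → ∑ (map (bracketProd k (+ 0)) (extendSigns n V))) (signSets n))
      ≈⟨ ∑-map-cong (signSets n) extendSigns-sum ⟩
    ∑ (map (λ V → ([ suc k ] + [ k ]) * bracketProd k (+ 0) V) (signSets n))
      ≈⟨ ∑-map-*ˡ (signSets n) (bracketProd k (+ 0)) _ ⟩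
    ([ suc k ] + [ k ]) * ∑ (map (bracketProd k (+ 0)) (signSets n))
      ≈⟨ *-cong refl (∑-bracketProd-signSets n k) ⟩
    ([ suc k ] + [ k ]) ^ suc n ∎
    where
    open SetoidReasoning setoid
    -- -[1+ n ] lies below the cut at 0 and + suc n above it.
    extendSigns-sum : ∀ V → ∑ (map (bracketProd k (+ 0)) (extendSigns n V)) ≈
                            ([ suc k ] + [ k ]) * bracketProd k (+ 0) V
    extendSigns-sum V = begin
      [ k ] * Π + (bracketProd k (+ 0) (V ++ + suc n ∷ []) + 0#)
        ≈⟨ +-cong refl (+-cong (trans (reflexive (≡.cong ∏ (List.map-++ _ V (+ suc n ∷ []))))
                                      (∏-++ (map _ V) _)) refl) ⟩
      [ k ] * Π + (Π * ([ suc k ] * 1#) + 0#)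
        ≈⟨ solve 3 (λ a b p → a :* p :+ (p :* (b :* con 1) :+ con 0) := (b :+ a) :* p) refl
             [ k ] [ suc k ] Π ⟩
      ([ suc k ] + [ k ]) * Π ∎
      where Π = bracketProd k (+ 0) V

  descentSeries-signedPermutations : ∀ n L → Unique L → (∀ w → (w ∈ L) ⇔ IsSignedPerm n w) →
    descentSeries 0 (+ 0) L ≋ (λ k → ([ suc k ] + [ k ]) ^ n) ⊗ denominator 0 n
  descentSeries-signedPermutations n L unique L⇔B = begin
    descentSeries 0 (+ 0) L
      ≈⟨ ∑ₛ.∑-↭ (↭.map⁺ (descentMonomial 0 (+ 0)) (↭-signedPermutations n L unique L⇔B)) ⟩
    descentSeries 0 (+ 0) (signedPermutations n)
      ≈⟨ ∑ₛ.∑-concatMap (signSets n) (permutations n) (descentMonomial 0 (+ 0)) ⟩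
    sumS (map (λ V → descentSeries 0 (+ 0) (permutations n V)) (signSets n))
      ≈⟨ ∑ₛ.∑-map-cong-All (All.tabulate (λ V∈ → let open IsSignSet (signSets-IsSignSet n V∈) in
           descentSeries-permutations n 0 (+ 0) _ length≡ sorted)) ⟩
    sumS (map (λ V → boxSeries 0 (+ 0) V ⊗ denominator 0 n) (signSets n))
      ≈⟨ ∑ₛ.∑-map-*ʳ (signSets n) (boxSeries 0 (+ 0)) (denominator 0 n) ⟩
    sumS (map (boxSeries 0 (+ 0)) (signSets n)) ⊗ denominator 0 n
      ≈⟨ ⊗-congʳ (denominator 0 n) ∑-boxSeries ⟩
    (λ k → ([ suc k ] + [ k ]) ^ n) ⊗ denominator 0 n ∎
    where
    open ≋-Reasoning
    open Permutations {ℤ} using (permutations)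
    ∑-boxSeries : sumS (map (boxSeries 0 (+ 0)) (signSets n)) ≋ (λ k → ([ suc k ] + [ k ]) ^ n)
    ∑-boxSeries k = trans (sumS-coeff (signSets n) (boxSeries 0 (+ 0)) k)
      (trans (∑-map-cong (signSets n) (λ V → trans (*-cong q^-zero refl) (*-identityˡ _)))
             (∑-bracketProd-signSets n k))

module ℤ[[q]] = PowerSeries ℤ.+-*-commutativeRing
module ℤ[[q]][[t]] = PowerSeries ℤ[[q]].⊕-⊗-commutativeRing

qPow-+ : ∀ a b → qPow (a ℕ.+ b) ℤ[[q]].≋ qPow a PQ.⊗ qPow b
qPow-+ a b = ℤ[[q]].≋-sym (ℤ[[q]].monoS-⊗-monoS (+ 1) a (+ 1) b)

qInt-suc : ∀ k → qInt (suc k) ℤ[[q]].≋ qInt k PQ.⊕ qPow k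
qInt-suc k a with ℕ.<-cmp a k
... | tri< a<k a≢k _
  rewrite dec-true (a ℕ.<? suc k) (ℕ.m<n⇒m<1+n a<k) | dec-true (a ℕ.<? k) a<k
        | dec-false (a ℕ.≟ k) a≢k = ≡.refl
... | tri≈ _ ≡.refl _
  rewrite dec-true (a ℕ.<? suc a) (ℕ.n<1+n a) | dec-false (a ℕ.<? a) (ℕ.<-irrefl ≡.refl)
        | dec-true (a ℕ.≟ a) ≡.refl = ≡.refl
... | tri> _ a≢k k<a
  rewrite dec-false (a ℕ.<? suc k) (ℕ.<⇒≱ k<a ∘ ℕ.≤-pred) | dec-false (a ℕ.<? k) (ℕ.<-asym k<a)
        | dec-false (a ℕ.≟ k) a≢k = ≡.refl

qIntegers : QIntegers ℤ[[q]].⊕-⊗-commutativeRing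
qIntegers = record
  { q^_ = qPow ; [_] = qInt ; q^-zero = ℤ[[q]].monoS-one ; q^-+ = qPow-+
  ; [0] = λ _ → ≡.refl ; [suc] = qInt-suc }

qIntegersAtOne : QIntegers ℤ.+-*-commutativeRing
qIntegersAtOne = record
  { q^_ = λ _ → + 1 ; [_] = +_ ; q^-zero = ≡.refl ; q^-+ = λ _ _ → ≡.refl
  ; [0] = ≡.refl ; [suc] = λ k → ≡.cong +_ (ℕ.+-comm 1 k) }

module CrossPolytope where
  open CommutativeRing ℤ[[q]].⊕-⊗-commutativeRing
  open ListSum ℤ[[q]].⊕-⊗-commutativeRing
  open ℤ[[q]][[t]] using (sumUpTo; sumUpTo-split; sumUpTo-cong; sumUpTo-cong<; sumUpTo-reverse; ∑-map-upTo)
  open SetoidReasoning setoid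

  k∸∣i-k∣≡i : ∀ {k i} → i ℕ.≤ k → k ∸ ∣ + i ℤ.- + k ∣ ≡ i
  k∸∣i-k∣≡i {k} {i} i≤k =
    ≡.trans (≡.cong (k ∸_) (≡.trans (≡.cong ∣_∣ (ℤ.m-n≡m⊖n i k)) (ℤ.∣⊖∣-≤ i≤k))) (ℕ.m∸[m∸n]≡n i≤k)

  ∣k+j-k∣≡j : ∀ k j → ∣ + (k ℕ.+ j) ℤ.- + k ∣ ≡ j
  ∣k+j-k∣≡j k j =
    ≡.trans (≡.cong ∣_∣ (≡.trans (ℤ.m-n≡m⊖n (k ℕ.+ j) k) (ℤ.⊖-≥ (ℕ.m≤m+n k j)))) (ℕ.m+n∸m≡n k j)

  qInt-sumUpTo : ∀ m → qInt m ≈ sumUpTo m qPow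
  qInt-sumUpTo zero    a = ≡.refl
  qInt-sumUpTo (suc m) = trans (qInt-suc m) (+-cong (qInt-sumUpTo m) refl)

  ∑-range : ∀ k → ∑ (map (λ y → qPow (k ∸ ∣ y ∣)) (range k)) ≈ qInt (suc k) + qInt k
  ∑-range k = begin
    ∑ (map (λ y → qPow (k ∸ ∣ y ∣)) (range k))             ≡⟨ ≡.cong ∑ (List.map-∘ {g = λ y → qPow (k ∸ ∣ y ∣)} (upTo (suc (2 ℕ.* k)))) ⟨
    ∑ (map g (upTo (suc (2 ℕ.* k))))                       ≈⟨ ∑-map-upTo (suc (2 ℕ.* k)) g ⟩
    sumUpTo (suc (2 ℕ.* k)) g                              ≡⟨ ≡.cong (λ m → sumUpTo m g) (1+2k≡k+[1+k] k) ⟩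
    sumUpTo (k ℕ.+ suc k) g                                ≈⟨ sumUpTo-split k (suc k) g ⟩
    sumUpTo k g + sumUpTo (suc k) (λ j → g (k ℕ.+ j))      ≈⟨ +-cong (sumUpTo-cong< k {g} {qPow} left) (sumUpTo-cong (suc k) {g ∘ (k ℕ.+_)} {λ j → qPow (k ∸ j)} right) ⟩
    sumUpTo k qPow + sumUpTo (suc k) (λ j → qPow (k ∸ j))  ≈⟨ +-cong (refl {sumUpTo k qPow}) (sumUpTo-reverse (suc k) qPow) ⟨
    sumUpTo k qPow + sumUpTo (suc k) qPow                  ≈⟨ +-comm (sumUpTo k qPow) _ ⟩
    sumUpTo (suc k) qPow + sumUpTo k qPow                  ≈⟨ +-cong (qInt-sumUpTo (suc k)) (qInt-sumUpTo k) ⟨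
    qInt (suc k) + qInt k                                  ∎
    where
    g : ℕ → P
    g i = qPow (k ∸ ∣ + i ℤ.- + k ∣)
    1+2k≡k+[1+k] : ∀ k → suc (2 ℕ.* k) ≡ k ℕ.+ suc k
    1+2k≡k+[1+k] = solve-∀
    left : ∀ i → i ℕ.< k → g i ≈ qPow i
    left i i<k = reflexive (≡.cong qPow (k∸∣i-k∣≡i (ℕ.<⇒≤ i<k)))
    right : ∀ j → g (k ℕ.+ j) ≈ qPow (k ∸ j)
    right j = reflexive (≡.cong (λ m → qPow (k ∸ m)) (∣k+j-k∣≡j k j))

  qSeries-Ehr : ∀ n k → (qInt (suc k) + qInt k) PQ.^S n ≈ Ehr n k
  qSeries-Ehr zero    k = sym (trans (+-identityʳ _) ℤ[[q]].monoS-one)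
  qSeries-Ehr (suc n) k = begin
    x * x PQ.^S n                                            ≈⟨ *-cong (sym (∑-range k)) (qSeries-Ehr n k) ⟩
    ∑ (map (λ y → qPow (k ∸ ∣ y ∣)) (range k)) * Ehr n k     ≈⟨ ∑-map-*ʳ (range k) (λ y → qPow (k ∸ ∣ y ∣)) (Ehr n k) ⟨
    ∑ (map (λ y → qPow (k ∸ ∣ y ∣) * Ehr n k) (range k))     ≈⟨ ∑-map-cong (range k) prepend ⟩
    ∑ (map (λ y → ∑ (map weight (map (y ∷_) (box k n)))) (range k))
      ≈⟨ ∑-concatMap (range k) (λ y → map (y ∷_) (box k n)) weight ⟨
    Ehr (suc n) k ∎
    where
    x = qInt (suc k) + qInt k
    weight : List ℤ → P
    weight z = qPow (muBar k z)
    prepend : ∀ y → qPow (k ∸ ∣ y ∣) * Ehr n k ≈ ∑ (map weight (map (y ∷_) (box k n)))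
    prepend y = begin
      qPow (k ∸ ∣ y ∣) * Ehr n k                                  ≈⟨ ∑-map-*ˡ (box k n) weight (qPow (k ∸ ∣ y ∣)) ⟨
      ∑ (map (λ z → qPow (k ∸ ∣ y ∣) * weight z) (box k n))       ≈⟨ ∑-map-cong (box k n) (λ z → sym (qPow-+ _ (muBar k z))) ⟩
      ∑ (map (weight ∘ (y ∷_)) (box k n))                         ≡⟨ ≡.cong ∑ (List.map-∘ (box k n)) ⟩
      ∑ (map weight (map (y ∷_) (box k n)))                       ∎

module Cq = Carlitz qIntegers
module Bq = TypeB qIntegers
module Cu = Carlitz qIntegersAtOne
module Bu = TypeB qIntegersAtOne
module ℤ[[t]] = PowerSeries ℤ.+-*-commutativeRing

open Exp (CommutativeRing.semiring ℤ.+-*-commutativeRing) using () renaming (_^_ to _^ℤ_)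

pos-^ : ∀ m n → (+ m) ^ℤ n ≡ + (m ℕ.^ n)
pos-^ m zero    = ≡.refl
pos-^ m (suc n) = ≡.trans (≡.cong (+ m ℤ.*_) (pos-^ m n)) (≡.sym (ℤ.pos-* m (m ℕ.^ n)))

CB-over-denom : ∀ n L → Unique L → (∀ w → (w ∈ L) ⇔ IsSignedPerm n w) →
                (CB L TQ.⊗ TQ.invS (denom n)) ≈T qSeries n
CB-over-denom n L unique L⇔B = ℤ[[q]][[t]].≋-trans
  (ℤ[[q]][[t]].⊗-invS-cancelʳ (denom n) (Cq.denominator-constant 0 n)
    (Bq.descentSeries-signedPermutations n L unique L⇔B))
  (λ k → ℤ[[q]].^⊗≋^S (qInt (suc k) PQ.⊕ qInt k) n)

CBdes-over-[1-t]^n+1 : ∀ n L → Unique L → (∀ w → (w ∈ L) ⇔ IsSignedPerm n w) →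
  (λ k → + (suc (2 ℕ.* k) ℕ.^ n)) ≈U (CBdes L U.⊗ U.invS ((U.oneS U.⊝ U.monoS (+ 1) 1) U.^S suc n))
CBdes-over-[1-t]^n+1 n L unique L⇔B k = ≡.sym (begin
  (CBdes L ⊗ invS F) k        ≡⟨ ⊗-invS-cancelʳ F {h = coefficients} F₀ CBdes≋ k ⟩
  (+ (suc k ℕ.+ k)) ^ℤ n      ≡⟨ pos-^ (suc k ℕ.+ k) n ⟩
  + ((suc k ℕ.+ k) ℕ.^ n)     ≡⟨ ≡.cong (λ m → + (m ℕ.^ n)) (1+k+k≡1+2k k) ⟩
  + (suc (2 ℕ.* k) ℕ.^ n)     ∎)
  where
  open ℤ[[t]]
  open ≡.≡-Reasoning
  F = (1- + 1 ·t) ^S suc n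
  denominator≋F : Cu.denominator 0 n ≋ F
  denominator≋F = ≋-trans (prodS-const (1- + 1 ·t) (applyUpTo (0 ℕ.+_) (suc n)))
                          (≡⇒≋ (≡.cong ((1- + 1 ·t) ^S_) (List.length-applyUpTo (0 ℕ.+_) (suc n))))
  F₀ : F 0 ≡ + 1
  F₀ = ≡.trans (≡.sym (denominator≋F 0)) (Cu.denominator-constant 0 n)
  coefficients : Ser
  coefficients k = (+ (suc k ℕ.+ k)) ^ℤ n
  CBdes≋ : CBdes L ≋ coefficients ⊗ F
  CBdes≋ = ≋-trans (Bu.descentSeries-signedPermutations n L unique L⇔B) (⊗-congˡ coefficients denominator≋F)
  1+k+k≡1+2k : ∀ k → suc k ℕ.+ k ≡ suc (2 ℕ.* k)
  1+k+k≡1+2k = solve-∀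

corollary3p4 : (n : ℕ) (L : List (List ℤ)) → Unique L
    → (∀ w → (w ∈ L) ⇔ IsSignedPerm n w)
    → ((CB L TQ.⊗ TQ.invS (denom n)) ≈T qSeries n)
      × (qSeries n ≈T Ehr n)
      × ((λ k → + ((suc (2 ℕ.* k)) ℕ.^ n))
          ≈U (CBdes L U.⊗ U.invS ((U.oneS U.⊝ U.monoS (+ 1) 1) U.^S suc n)))
corollary3p4 n L unique L⇔B =
  CB-over-denom n L unique L⇔B , CrossPolytope.qSeries-Ehr n , CBdes-over-[1-t]^n+1 n L unique L⇔B
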